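{- For all integers $1\leq k\leq n$: \[\text{(i)}\quad A_{n,k}=\sum_{j=1}^{n-k+1}\binom{n-1}{j-1}A_{j,1}\,A_{n-j,k-1},\qquad \text{(ii)}\quad B_{n,k}=\sum_{j=1}^{n-k+1}\binom{n-1}{j-1}B_{j,1}\,B_{n-j,k-1}.\]
   Context: Let $R=\mathbb{Z}[X_1,X_1^{ -1},X_2,X_3,\ldots]$. Partial exponential Bell polynomials: $B_{0,0}=1$, $B_{n,0}=0$ for $n\geq1$, $B_{n,k}=0$ for $0\leq n<k$, and for $1\leq k\leq n$, $B_{n,k}=\sum \frac{n!}{r_1!\cdots r_{n-k+1}!\,(1!)^{r_1}\cdots((n-k+1)!)^{r_{n-k+1}}}X_1^{r_1}\cdots X_{n-k+1}^{r_{n-k+1}}$, summed over nonnegative integers $r_i$ with $\sum r_i=k$, $\sum i r_i=n$. Elements $S_{n,k}\in R$: $S_{0,0}=X_1^{ -1}$, $S_{n,0}=0$ ($n\geq1$), $S_{n,k}=0$ ($0\leq n<k$), and for $n\geq0$, $1\leq k\leq n+1$: $S_{n+1,k}=-(2n-1)X_2S_{n,k}+X_1\big(S_{n,k-1}+\sum_{j=1}^{n-k+1}X_{j+1}\,\partial S_{n,k}/\partial X_j\big)$. Set $A_{n,k}:=X_1^{ -(2n-1)}S_{n,k}$. -}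

module Defs where

open import Data.Bool using (Bool; true; false; _∧_; if_then_else_)
open import Data.Nat as ℕ using (ℕ; zero; suc; _∸_; _≤ᵇ_; _≡ᵇ_; NonZero)
open import Data.Nat.Properties using (m*n≢0; m^n≢0; _!≢0)
open import Data.Nat.DivMod using (_/_)
open import Data.Nat.Combinatorics using (_C_)
open import Data.Integer as ℤ using (ℤ; +_; -_)
open import Data.List using (List; []; _∷_; _++_; concatMap; map; foldr; filter; upTo)
open import Data.Product using (_×_; _,_)
open import Relation.Binary.PropositionalEquality using (_≡_)
open import Relation.Nullary.Decidable using (⌊_⌋)

-- The ring R = ℤ[X₁, X₁⁻¹, X₂, X₃, …]
--
-- A monomial X₁^e₁ X₂^e₂ X₃^e₃ ⋯ is stored as (e₁ , [e₂ , e₃ , …]),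
-- with e₁ ∈ ℤ and finitely many exponents eᵢ ∈ ℕ for i ≥ 2
-- (missing trailing exponents are 0).

Mon : Set
Mon = ℤ × List ℕ

eqExps : List ℕ → List ℕ → Bool
eqExps []       []       = true
eqExps []       (y ∷ ys) = (y ≡ᵇ 0) ∧ eqExps [] ys
eqExps (x ∷ xs) []       = (x ≡ᵇ 0) ∧ eqExps xs []
eqExps (x ∷ xs) (y ∷ ys) = (x ≡ᵇ y) ∧ eqExps xs ys

eqMon : Mon → Mon → Bool
eqMon (a , r) (b , s) = ⌊ a ℤ.≟ b ⌋ ∧ eqExps r s

addExps : List ℕ → List ℕ → List ℕ
addExps []       ys       = ys
addExps (x ∷ xs) []       = x ∷ xs
addExps (x ∷ xs) (y ∷ ys) = (x ℕ.+ y) ∷ addExps xs ys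

mulMon : Mon → Mon → Mon
mulMon (a , r) (b , s) = (a ℤ.+ b , addExps r s)

Poly : Set
Poly = List (ℤ × Mon)

coeff : Poly → Mon → ℤ
coeff []             m = + 0
coeff ((c , m') ∷ p) m = (if eqMon m m' then c else + 0) ℤ.+ coeff p m

infix 4 _≈_
_≈_ : Poly → Poly → Set
p ≈ q = ∀ m → coeff p m ≡ coeff q m

0P : Poly
0P = []

1P : Poly
1P = (+ 1 , (+ 0 , [])) ∷ []

infixl 6 _+P_
_+P_ : Poly → Poly → Poly
p +P q = p ++ q

infixl 7 _*P_
_*P_ : Poly → Poly → Poly
p *P q = concatMap (λ { (c , m) → map (λ { (d , m') → (c ℤ.* d , mulMon m m') }) q }) p

infixl 7 _·P_
_·P_ : ℤ → Poly → Poly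
a ·P p = map (λ { (c , m) → (a ℤ.* c , m) }) p

X₁^ : ℤ → Poly
X₁^ e = (+ 1 , (e , [])) ∷ []

-- exponent list with a single 1 at position i (0-based), i.e. X_{i+2}
unitExps : ℕ → List ℕ
unitExps zero    = 1 ∷ []
unitExps (suc i) = 0 ∷ unitExps i

-- the variable X_i (i ≥ 1); X 0 is not used
X : ℕ → Poly
X zero          = 0P
X (suc zero)    = X₁^ (+ 1)
X (suc (suc i)) = (+ 1 , (+ 0 , unitExps i)) ∷ []

lookupE : List ℕ → ℕ → ℕ
lookupE []       _       = 0
lookupE (x ∷ xs) zero    = x
lookupE (x ∷ xs) (suc i) = lookupE xs i

decE : List ℕ → ℕ → List ℕ
decE []       _       = []
decE (x ∷ xs) zero    = (x ∸ 1) ∷ xs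
decE (x ∷ xs) (suc i) = x ∷ decE xs i

-- partial derivative ∂/∂X_j  (j ≥ 1); ∂ 0 is unused
∂ : ℕ → Poly → Poly
∂ zero          p = 0P
∂ (suc zero)    p = map (λ { (c , (e , r)) → (c ℤ.* e , (e ℤ.- + 1 , r)) }) p
∂ (suc (suc i)) p =
  map (λ { (c , (e , r)) → (c ℤ.* + lookupE r i , (e , decE r i)) }) p

ΣP : ℕ → (ℕ → Poly) → Poly
ΣP zero    f = 0P
ΣP (suc m) f = ΣP m f +P f (suc m)

S : ℕ → ℕ → Poly
S zero    zero    = X₁^ (- + 1)
S zero    (suc k) = 0P
S (suc n) zero    = 0P
S (suc n) (suc k') with suc k' ≤ᵇ suc n
... | false = 0P
... | true  =
  -- k = suc k', 1 ≤ k ≤ n+1;  n - k + 1 = n ∸ k'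
  ((- ((+ 2 ℤ.* + n) ℤ.- + 1)) ·P (X 2 *P S n (suc k')))
  +P (X 1 *P (S n k' +P ΣP (n ∸ k') (λ j → X (suc j) *P ∂ j (S n (suc k')))))

A : ℕ → ℕ → Poly
A n k = X₁^ (- ((+ 2 ℤ.* + n) ℤ.- + 1)) *P S n k

-- Partial exponential Bell polynomials

tuples : ℕ → ℕ → List (List ℕ)
tuples zero    b = [] ∷ []
tuples (suc m) b = concatMap (λ r → map (r ∷_) (tuples m b)) (upTo (suc b))

sumL : List ℕ → ℕ
sumL = foldr ℕ._+_ 0

wsum : ℕ → List ℕ → ℕ
wsum i []       = 0
wsum i (r ∷ rs) = i ℕ.* r ℕ.+ wsum (suc i) rs

den : ℕ → List ℕ → ℕ
den i []       = 1
den i (r ∷ rs) = (r ℕ.! ℕ.* (i ℕ.!) ℕ.^ r) ℕ.* den (suc i) rs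

den≢0 : ∀ i rs → NonZero (den i rs)
den≢0 i []       = _
den≢0 i (r ∷ rs) =
  m*n≢0 (r ℕ.! ℕ.* (i ℕ.!) ℕ.^ r) (den (suc i) rs)
    {{m*n≢0 (r ℕ.!) ((i ℕ.!) ℕ.^ r) {{r !≢0}} {{m^n≢0 (i ℕ.!) r {{i !≢0}}}}}}
    {{den≢0 (suc i) rs}}

-- n! / ∏ rᵢ! (i!)^{rᵢ}   (an exact division)
bellCoeff : ℕ → List ℕ → ℕ
bellCoeff n rs = (n ℕ.!) / den 1 rs
  where instance _ = den≢0 1 rs

rMon : List ℕ → Mon
rMon []       = (+ 0 , [])
rMon (r ∷ rs) = (+ r , rs)

B : ℕ → ℕ → Poly
B zero    zero    = 1P
B (suc n) zero    = 0P
B n       (suc k') with suc k' ≤ᵇ n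
... | false = 0P
... | true  =
  map (λ rs → (+ bellCoeff n rs , rMon rs))
      (filter (λ rs → (sumL rs ℕ.≟ suc k') Relation.Nullary.Decidable.×-dec (wsum 1 rs ℕ.≟ n))
              (tuples (n ∸ suc k' ℕ.+ 1) (suc k')))

-- Elements of R are lists of terms compared coefficientwise; Monomials,
-- Linear and Ring make R a commutative ring with a ring solver.
-- (i): D = Σⱼ X_{j+1} ∂ⱼ is a derivation (Derivation) whose truncation is
-- irrelevant on S_{n,k} (Support), and the recursion of S becomes
-- A_{n+1,k+1} = X₁⁻¹ (A_{n,k} + D A_{n,k+1}); induction on n with the
-- Leibniz and Pascal rules gives (i) (PartI).
-- (ii): the coefficient of B_{n,k} at a partition type t is n!/den t
-- (BellPoly), B_{j,1} = X_j and X_{p+1} shifts coefficients (PartII), which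
-- reduces (ii) to the count n!/den t = Σ_p C(n-1,p) (n-1-p)!/den(t - eₚ)
-- of the possible blocks containing a fixed element (BellNumbers).
module Submission where


-- Monomials X₁^e X₂^{r₀} X₃^{r₁} ⋯ are pairs (e , r) whose exponent list r
-- may carry trailing zeros, so the boolean test eqMon of Defs identifies
-- lists up to padding.
module Monomials where

  open import Defs
  open import Data.Bool using (true; _∧_)
  open import Data.Bool.Properties using (∧-conicalˡ; ∧-conicalʳ)
  open import Data.Nat as ℕ using (zero; suc; _∸_)
  import Data.Nat.Properties as ℕP
  open import Data.Integer as ℤ using (+_)
  import Data.Integer.Properties as ℤP
  open import Data.List using ([]; _∷_)
  open import Data.Product using (_,_; proj₁; proj₂)
  open import Data.Empty using (⊥; ⊥-elim)
  open import Relation.Binary.PropositionalEquality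
  open import Relation.Nullary using (yes; no)
  open import Relation.Nullary.Decidable using (⌊_⌋)

  ≡ᵇ-sound : ∀ x y → (x ℕ.≡ᵇ y) ≡ true → x ≡ y
  ≡ᵇ-sound zero    zero    _ = refl
  ≡ᵇ-sound (suc x) (suc y) e = cong suc (≡ᵇ-sound x y e)

  ≡ᵇ-refl : ∀ x → (x ℕ.≡ᵇ x) ≡ true
  ≡ᵇ-refl zero    = refl
  ≡ᵇ-refl (suc x) = ≡ᵇ-refl x

  ≟-sound : ∀ a b → ⌊ a ℤ.≟ b ⌋ ≡ true → a ≡ b
  ≟-sound a b e with a ℤ.≟ b
  ... | yes p = p

  ≟-refl : ∀ a → ⌊ a ℤ.≟ a ⌋ ≡ true
  ≟-refl a with a ℤ.≟ a
  ... | yes _ = refl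
  ... | no a≢a = ⊥-elim (a≢a refl)

  eqExps-sound : ∀ r s → eqExps r s ≡ true → ∀ i → lookupE r i ≡ lookupE s i
  eqExps-sound []       []       e i       = refl
  eqExps-sound []       (y ∷ ys) e zero    = sym (≡ᵇ-sound y 0 (∧-conicalˡ _ _ e))
  eqExps-sound []       (y ∷ ys) e (suc i) = eqExps-sound [] ys (∧-conicalʳ _ _ e) i
  eqExps-sound (x ∷ xs) []       e zero    = ≡ᵇ-sound x 0 (∧-conicalˡ _ _ e)
  eqExps-sound (x ∷ xs) []       e (suc i) = eqExps-sound xs [] (∧-conicalʳ _ _ e) i
  eqExps-sound (x ∷ xs) (y ∷ ys) e zero    = ≡ᵇ-sound x y (∧-conicalˡ _ _ e)
  eqExps-sound (x ∷ xs) (y ∷ ys) e (suc i) = eqExps-sound xs ys (∧-conicalʳ _ _ e) i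

  eqExps-complete : ∀ r s → (∀ i → lookupE r i ≡ lookupE s i) → eqExps r s ≡ true
  eqExps-complete [] [] h = refl
  eqExps-complete [] (y ∷ ys) h =
    cong₂ _∧_ (subst (λ z → (z ℕ.≡ᵇ 0) ≡ true) (h zero) refl) (eqExps-complete [] ys (λ i → h (suc i)))
  eqExps-complete (x ∷ xs) [] h =
    cong₂ _∧_ (subst (λ z → (z ℕ.≡ᵇ 0) ≡ true) (sym (h zero)) refl) (eqExps-complete xs [] (λ i → h (suc i)))
  eqExps-complete (x ∷ xs) (y ∷ ys) h =
    cong₂ _∧_ (subst (λ z → (x ℕ.≡ᵇ z) ≡ true) (h zero) (≡ᵇ-refl x)) (eqExps-complete xs ys (λ i → h (suc i)))

  record _∼_ (m m' : Mon) : Set where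
    constructor mk∼
    field get∼ : eqMon m m' ≡ true
  open _∼_ public

  record MonEq (m m' : Mon) : Set where
    constructor meq
    field
      fstEq : proj₁ m ≡ proj₁ m'
      lkEq  : ∀ i → lookupE (proj₂ m) i ≡ lookupE (proj₂ m') i
  open MonEq public

  ∼⇒MonEq : ∀ {m m'} → m ∼ m' → MonEq m m'
  ∼⇒MonEq {a , r} {b , s} (mk∼ e) =
    meq (≟-sound a b (∧-conicalˡ _ _ e)) (eqExps-sound r s (∧-conicalʳ _ _ e))

  MonEq⇒∼ : ∀ {m m'} → MonEq m m' → m ∼ m'
  MonEq⇒∼ {a , r} {b , s} (meq p q) =
    mk∼ (cong₂ _∧_ (subst (λ z → ⌊ a ℤ.≟ z ⌋ ≡ true) p (≟-refl a)) (eqExps-complete r s q))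

  ∼-refl : ∀ m → m ∼ m
  ∼-refl m = MonEq⇒∼ (meq refl (λ i → refl))

  ∼-sym : ∀ {m m'} → m ∼ m' → m' ∼ m
  ∼-sym e = let h = ∼⇒MonEq e in MonEq⇒∼ (meq (sym (fstEq h)) (λ i → sym (lkEq h i)))

  ∼-trans : ∀ {m m' m''} → m ∼ m' → m' ∼ m'' → m ∼ m''
  ∼-trans e f = let h = ∼⇒MonEq e ; k = ∼⇒MonEq f in
    MonEq⇒∼ (meq (trans (fstEq h) (fstEq k)) (λ i → trans (lkEq h i) (lkEq k i)))

  lookup-add : ∀ r s i → lookupE (addExps r s) i ≡ lookupE r i ℕ.+ lookupE s i
  lookup-add []       s        i       = refl
  lookup-add (x ∷ xs) []       zero    = sym (ℕP.+-identityʳ x)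
  lookup-add (x ∷ xs) []       (suc i) = sym (ℕP.+-identityʳ _)
  lookup-add (x ∷ xs) (y ∷ ys) zero    = refl
  lookup-add (x ∷ xs) (y ∷ ys) (suc i) = lookup-add xs ys i

  mulMon-resp : ∀ {m₁ m₁' m₂ m₂'} → m₁ ∼ m₁' → m₂ ∼ m₂' → mulMon m₁ m₂ ∼ mulMon m₁' m₂'
  mulMon-resp {a , r} {a' , r'} {b , s} {b' , s'} e f =
    let h = ∼⇒MonEq e ; k = ∼⇒MonEq f in
    MonEq⇒∼ (meq (cong₂ ℤ._+_ (fstEq h) (fstEq k))
      (λ i → trans (lookup-add r s i) (trans (cong₂ ℕ._+_ (lkEq h i) (lkEq k i)) (sym (lookup-add r' s' i)))))

  addExps-comm : ∀ r s → addExps r s ≡ addExps s r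
  addExps-comm []      []      = refl
  addExps-comm []      (x ∷ s) = refl
  addExps-comm (x ∷ r) []      = refl
  addExps-comm (x ∷ r) (y ∷ s) = cong₂ _∷_ (ℕP.+-comm x y) (addExps-comm r s)

  addExps-assoc : ∀ r s t → addExps (addExps r s) t ≡ addExps r (addExps s t)
  addExps-assoc []      s       t       = refl
  addExps-assoc (x ∷ r) []      t       = refl
  addExps-assoc (x ∷ r) (y ∷ s) []      = refl
  addExps-assoc (x ∷ r) (y ∷ s) (z ∷ t) = cong₂ _∷_ (ℕP.+-assoc x y z) (addExps-assoc r s t)

  mulMon-comm : ∀ m m' → mulMon m m' ≡ mulMon m' m
  mulMon-comm (a , r) (b , s) = cong₂ _,_ (ℤP.+-comm a b) (addExps-comm r s)

  mulMon-assoc : ∀ m₁ m₂ m₃ → mulMon (mulMon m₁ m₂) m₃ ≡ mulMon m₁ (mulMon m₂ m₃)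
  mulMon-assoc (a , r) (b , s) (c , t) = cong₂ _,_ (ℤP.+-assoc a b c) (addExps-assoc r s t)

  mulMon-identityˡ : ∀ m → mulMon (+ 0 , []) m ≡ m
  mulMon-identityˡ (a , r) = cong (_, r) (ℤP.+-identityˡ a)

  lookup-decE-same : ∀ r i → lookupE (decE r i) i ≡ lookupE r i ∸ 1
  lookup-decE-same []      i       = refl
  lookup-decE-same (x ∷ r) zero    = refl
  lookup-decE-same (x ∷ r) (suc i) = lookup-decE-same r i

  lookup-decE-other : ∀ r i k → (i ≡ k → ⊥) → lookupE (decE r i) k ≡ lookupE r k
  lookup-decE-other []      i       k       i≢k = refl
  lookup-decE-other (x ∷ r) zero    zero    i≢k = ⊥-elim (i≢k refl)
  lookup-decE-other (x ∷ r) zero    (suc k) i≢k = refl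
  lookup-decE-other (x ∷ r) (suc i) zero    i≢k = refl
  lookup-decE-other (x ∷ r) (suc i) (suc k) i≢k = lookup-decE-other r i k (λ e → i≢k (cong suc e))


-- Every function g : Mon → ℤ extends ℤ-linearly to a functional on Poly.
-- Coefficient extraction is the extension of a Kronecker delta, and the
-- product of polynomials is a double sum; so all identities in R below are
-- reduced to identities between such functionals.  The key fact is that
-- the extension of a ∼-invariant g only depends on the element of R
-- represented (linExt-≈), which is proved via the vanishing lemma.
module Linear where

  open import Defs
  open Monomials
  open import Data.Bool using (true; false; if_then_else_)
  open import Data.Nat as ℕ using (suc)
  import Data.Nat.Properties as ℕP
  open import Data.Integer as ℤ using (ℤ; +_; -_)
  import Data.Integer.Properties as ℤP
  open import Data.Integer.Solver using (module +-*-Solver)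
  open import Data.List using ([]; _∷_; _++_; map; length)
  open import Data.Product using (_,_)
  open import Relation.Binary.PropositionalEquality
  open +-*-Solver

  linExt : (Mon → ℤ) → Poly → ℤ
  linExt g []            = + 0
  linExt g ((c , m) ∷ p) = c ℤ.* g m ℤ.+ linExt g p

  δ : Mon → Mon → ℤ
  δ m m' = if eqMon m m' then + 1 else + 0

  Invariant : (Mon → ℤ) → Set
  Invariant g = ∀ {m m'} → m ∼ m' → g m ≡ g m'

  δ-invariant : ∀ m → Invariant (δ m)
  δ-invariant m {m₁} {m₂} e with eqMon m m₁ in p | eqMon m m₂ in q
  ... | true  | true  = refl
  ... | false | false = refl
  ... | true  | false with () ← trans (sym (get∼ (∼-trans (mk∼ {m} p) e))) q
  ... | false | true  with () ← trans (sym (get∼ (∼-trans (mk∼ {m} q) (∼-sym e)))) p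

  coeff-linExt : ∀ p m → coeff p m ≡ linExt (δ m) p
  coeff-linExt []             m = refl
  coeff-linExt ((c , m') ∷ p) m = cong₂ ℤ._+_ head (coeff-linExt p m)
    where
    head : (if eqMon m m' then c else + 0) ≡ c ℤ.* δ m m'
    head with eqMon m m'
    ... | true  = sym (ℤP.*-identityʳ c)
    ... | false = sym (ℤP.*-zeroʳ c)

  linExt-++ : ∀ g p q → linExt g (p ++ q) ≡ linExt g p ℤ.+ linExt g q
  linExt-++ g []            q = sym (ℤP.+-identityˡ _)
  linExt-++ g ((c , m) ∷ p) q =
    trans (cong (ℤ._+_ (c ℤ.* g m)) (linExt-++ g p q)) (sym (ℤP.+-assoc (c ℤ.* g m) _ _))

  linExt-· : ∀ a g p → linExt g (a ·P p) ≡ a ℤ.* linExt g p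
  linExt-· a g []            = sym (ℤP.*-zeroʳ a)
  linExt-· a g ((c , m) ∷ p) = trans (cong (ℤ._+_ (a ℤ.* c ℤ.* g m)) (linExt-· a g p)) (
    solve 4 (λ a c x u → a :* c :* x :+ a :* u := a :* (c :* x :+ u)) refl a c (g m) (linExt g p))

  linExt-ext : ∀ {g h} p → (∀ m → g m ≡ h m) → linExt g p ≡ linExt h p
  linExt-ext []            e = refl
  linExt-ext ((c , m) ∷ p) e = cong₂ ℤ._+_ (cong (c ℤ.*_) (e m)) (linExt-ext p e)

  linExt-+ : ∀ g h p → linExt (λ m → g m ℤ.+ h m) p ≡ linExt g p ℤ.+ linExt h p
  linExt-+ g h []            = refl
  linExt-+ g h ((c , m) ∷ p) rewrite linExt-+ g h p =
    solve 5 (λ c x y u v → c :* (x :+ y) :+ (u :+ v) := c :* x :+ u :+ (c :* y :+ v))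
      refl c (g m) (h m) (linExt g p) (linExt h p)

  linExt-scale : ∀ a g p → linExt (λ m → a ℤ.* g m) p ≡ a ℤ.* linExt g p
  linExt-scale a g []            = sym (ℤP.*-zeroʳ a)
  linExt-scale a g ((c , m) ∷ p) rewrite linExt-scale a g p =
    solve 4 (λ a c x u → c :* (a :* x) :+ a :* u := a :* (c :* x :+ u)) refl a c (g m) (linExt g p)

  linExt-0 : ∀ p → linExt (λ _ → + 0) p ≡ + 0
  linExt-0 []            = refl
  linExt-0 ((c , m) ∷ p) rewrite linExt-0 p | ℤP.*-zeroʳ c = refl

  linExt-* : ∀ h p q → linExt h (p *P q) ≡ linExt (λ m₁ → linExt (λ m₂ → h (mulMon m₁ m₂)) q) p
  linExt-* h []            q = refl
  linExt-* h ((c , m) ∷ p) q =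
    trans (linExt-++ h (row c m q) (p *P q)) (cong₂ ℤ._+_ (linExt-row q) (linExt-* h p q))
    where
    row : ℤ → Mon → Poly → Poly
    row c m = map (λ { (d , m') → (c ℤ.* d , mulMon m m') })
    linExt-row : ∀ q → linExt h (row c m q) ≡ c ℤ.* linExt (λ m₂ → h (mulMon m m₂)) q
    linExt-row []             = sym (ℤP.*-zeroʳ c)
    linExt-row ((d , m') ∷ q) rewrite linExt-row q =
      solve 4 (λ c d x u → c :* d :* x :+ c :* u := c :* (d :* x :+ u))
        refl c d (h (mulMon m m')) (linExt (λ m₂ → h (mulMon m m₂)) q)

  linExt-swap : ∀ (f : Mon → Mon → ℤ) p q →
    linExt (λ m₁ → linExt (f m₁) q) p ≡ linExt (λ m₂ → linExt (λ m₁ → f m₁ m₂) p) q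
  linExt-swap f []            q = sym (linExt-0 q)
  linExt-swap f ((c , m) ∷ p) q = begin
      c ℤ.* linExt (f m) q ℤ.+ linExt (λ m₁ → linExt (f m₁) q) p
    ≡⟨ cong₂ ℤ._+_ (sym (linExt-scale c (f m) q)) (linExt-swap f p q) ⟩
      linExt (λ m₂ → c ℤ.* f m m₂) q ℤ.+ linExt (λ m₂ → linExt (λ m₁ → f m₁ m₂) p) q
    ≡⟨ sym (linExt-+ _ _ q) ⟩
      linExt (λ m₂ → c ℤ.* f m m₂ ℤ.+ linExt (λ m₁ → f m₁ m₂) p) q ∎
    where open ≡-Reasoning

  coeff-++ : ∀ p q m → coeff (p ++ q) m ≡ coeff p m ℤ.+ coeff q m
  coeff-++ p q m = begin
    coeff (p ++ q) m                    ≡⟨ coeff-linExt (p ++ q) m ⟩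
    linExt (δ m) (p ++ q)               ≡⟨ linExt-++ (δ m) p q ⟩
    linExt (δ m) p ℤ.+ linExt (δ m) q   ≡⟨ sym (cong₂ ℤ._+_ (coeff-linExt p m) (coeff-linExt q m)) ⟩
    coeff p m ℤ.+ coeff q m             ∎
    where open ≡-Reasoning

  coeff-· : ∀ a p m → coeff (a ·P p) m ≡ a ℤ.* coeff p m
  coeff-· a p m = begin
    coeff (a ·P p) m           ≡⟨ coeff-linExt (a ·P p) m ⟩
    linExt (δ m) (a ·P p)      ≡⟨ linExt-· a (δ m) p ⟩
    a ℤ.* linExt (δ m) p       ≡⟨ cong (a ℤ.*_) (sym (coeff-linExt p m)) ⟩
    a ℤ.* coeff p m            ∎
    where open ≡-Reasoning

  without : Mon → Poly → Poly
  without m []             = []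
  without m ((c , m') ∷ q) = if eqMon m m' then without m q else (c , m') ∷ without m q

  without-length : ∀ m q → length (without m q) ℕ.≤ length q
  without-length m []             = ℕ.z≤n
  without-length m ((c , m') ∷ q) with eqMon m m'
  ... | true  = ℕP.m≤n⇒m≤1+n (without-length m q)
  ... | false = ℕ.s≤s (without-length m q)

  without-head : ∀ c m q → without m ((c , m) ∷ q) ≡ without m q
  without-head c m q rewrite get∼ (∼-refl m) = refl

  linExt-without : ∀ g → Invariant g → ∀ m q →
    linExt g q ≡ g m ℤ.* coeff q m ℤ.+ linExt g (without m q)
  linExt-without g inv m []             = sym (trans (ℤP.+-identityʳ _) (ℤP.*-zeroʳ (g m)))
  linExt-without g inv m ((c , m') ∷ q) with eqMon m m' in e
  ... | true = begin
      c ℤ.* g m' ℤ.+ linExt g q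
    ≡⟨ cong₂ (λ x y → c ℤ.* x ℤ.+ y) (sym (inv (mk∼ e))) (linExt-without g inv m q) ⟩
      c ℤ.* g m ℤ.+ (g m ℤ.* coeff q m ℤ.+ linExt g (without m q))
    ≡⟨ solve 4 (λ c x k u → c :* x :+ (x :* k :+ u) := x :* (c :+ k) :+ u)
         refl c (g m) (coeff q m) (linExt g (without m q)) ⟩
      g m ℤ.* (c ℤ.+ coeff q m) ℤ.+ linExt g (without m q) ∎
    where open ≡-Reasoning
  ... | false = begin
      c ℤ.* g m' ℤ.+ linExt g q
    ≡⟨ cong (ℤ._+_ (c ℤ.* g m')) (linExt-without g inv m q) ⟩
      c ℤ.* g m' ℤ.+ (g m ℤ.* coeff q m ℤ.+ linExt g (without m q))
    ≡⟨ solve 5 (λ c y x k u → c :* y :+ (x :* k :+ u) := x :* (con (+ 0) :+ k) :+ (c :* y :+ u))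
         refl c (g m') (g m) (coeff q m) (linExt g (without m q)) ⟩
      g m ℤ.* (+ 0 ℤ.+ coeff q m) ℤ.+ (c ℤ.* g m' ℤ.+ linExt g (without m q)) ∎
    where open ≡-Reasoning

  -- Induction on the length, removing the
  -- monomial of the head term together with all its ∼-copies.
  vanishing : ∀ n q → length q ℕ.≤ n → (∀ m → coeff q m ≡ + 0) →
    ∀ g → Invariant g → linExt g q ≡ + 0
  vanishing n       []             _         _  g inv = refl
  vanishing (suc n) ((c , m) ∷ q') (ℕ.s≤s ℓ) q≈0 g inv = begin
      linExt g q
    ≡⟨ linExt-without g inv m q ⟩
      g m ℤ.* coeff q m ℤ.+ linExt g (without m q)
    ≡⟨ cong₂ (λ a b → g m ℤ.* a ℤ.+ b) (q≈0 m) (vanishing n (without m q) shorter rest≈0 g inv) ⟩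
      g m ℤ.* + 0 ℤ.+ + 0
    ≡⟨ trans (ℤP.+-identityʳ _) (ℤP.*-zeroʳ (g m)) ⟩
      + 0 ∎
    where
    open ≡-Reasoning
    q = (c , m) ∷ q'
    shorter : length (without m q) ℕ.≤ n
    shorter rewrite without-head c m q' = ℕP.≤-trans (without-length m q') ℓ
    rest≈0 : ∀ m' → coeff (without m q) m' ≡ + 0
    rest≈0 m' = begin
        coeff (without m q) m'
      ≡⟨ coeff-linExt (without m q) m' ⟩
        linExt (δ m') (without m q)
      ≡⟨ solve 2 (λ x u → u := x :* con (+ 0) :+ u) refl (δ m' m) _ ⟩
        δ m' m ℤ.* + 0 ℤ.+ linExt (δ m') (without m q)
      ≡⟨ cong (λ z → δ m' m ℤ.* z ℤ.+ linExt (δ m') (without m q)) (sym (q≈0 m)) ⟩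
        δ m' m ℤ.* coeff q m ℤ.+ linExt (δ m') (without m q)
      ≡⟨ sym (linExt-without (δ m') (δ-invariant m') m q) ⟩
        linExt (δ m') q
      ≡⟨ sym (coeff-linExt q m') ⟩
        coeff q m'
      ≡⟨ q≈0 m' ⟩
        + 0 ∎

  linExt-≈ : ∀ g → Invariant g → ∀ p q → p ≈ q → linExt g p ≡ linExt g q
  linExt-≈ g inv p q p≈q = begin
      linExt g p
    ≡⟨ solve 2 (λ a b → a := (a :+ (:- con (+ 1)) :* b) :+ b) refl (linExt g p) (linExt g q) ⟩
      (linExt g p ℤ.+ - + 1 ℤ.* linExt g q) ℤ.+ linExt g q
    ≡⟨ cong (ℤ._+ linExt g q) (sym (trans (linExt-++ g p d) (cong (ℤ._+_ (linExt g p)) (linExt-· (- + 1) g q)))) ⟩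
      linExt g (p ++ d) ℤ.+ linExt g q
    ≡⟨ cong (ℤ._+ linExt g q) (vanishing _ (p ++ d) ℕP.≤-refl difference≈0 g inv) ⟩
      + 0 ℤ.+ linExt g q
    ≡⟨ ℤP.+-identityˡ _ ⟩
      linExt g q ∎
    where
    open ≡-Reasoning
    d = - + 1 ·P q
    difference≈0 : ∀ m → coeff (p ++ d) m ≡ + 0
    difference≈0 m = trans (coeff-++ p d m) (trans (cong₂ ℤ._+_ (p≈q m) (coeff-· (- + 1) q m))
      (solve 1 (λ a → a :+ (:- con (+ 1)) :* a := con (+ 0)) refl (coeff q m)))


-- Equality is the coefficientwise relation _≈_ of
-- Defs, wrapped in a record (_≋_) so that it can serve as the equality of a
-- setoid; every ring law is proved coefficientwise through linExt.
module Ring where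

  open import Defs
  open Monomials
  open Linear
  open import Data.Nat as ℕ using (ℕ; zero; suc)
  import Data.Nat.Properties as ℕP
  open import Data.Integer as ℤ using (ℤ; +_; -_)
  import Data.Integer.Solver as ℤ-Solver
  import Data.Integer.Properties as ℤP
  open import Data.List using ([]; _++_)
  import Data.List.Properties as LP
  open import Data.Product using (_,_)
  open import Data.Sum using (inj₁; inj₂)
  open import Data.Maybe using (Maybe; just; nothing)
  open import Relation.Binary.PropositionalEquality
  open import Relation.Nullary using (yes; no)
  open import Relation.Binary.Structures using (IsEquivalence)
  open import Relation.Binary.Bundles using (Setoid)
  open import Algebra.Bundles using (CommutativeRing)
  import Algebra.Solver.Ring.AlmostCommutativeRing as ACR
  import Algebra.Solver.Ring as RingSolver

  infix 4 _≋_
  record _≋_ (p q : Poly) : Set where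
    constructor mk≋
    field get≋ : p ≈ q
  open _≋_ public

  -P_ : Poly → Poly
  -P p = (- + 1) ·P p

  ≋-refl : ∀ {p} → p ≋ p
  ≋-refl = mk≋ (λ m → refl)

  ≋-sym : ∀ {p q} → p ≋ q → q ≋ p
  ≋-sym (mk≋ e) = mk≋ (λ m → sym (e m))

  ≋-trans : ∀ {p q r} → p ≋ q → q ≋ r → p ≋ r
  ≋-trans (mk≋ e) (mk≋ f) = mk≋ (λ m → trans (e m) (f m))

  ≡⇒≋ : ∀ {p q} → p ≡ q → p ≋ q
  ≡⇒≋ refl = ≋-refl

  +-cong : ∀ {p p' q q'} → p ≋ p' → q ≋ q' → (p +P q) ≋ (p' +P q')
  +-cong {p} {p'} {q} {q'} (mk≋ e) (mk≋ f) = mk≋ λ m →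
    trans (coeff-++ p q m) (trans (cong₂ ℤ._+_ (e m) (f m)) (sym (coeff-++ p' q' m)))

  +-assoc : ∀ p q r → ((p +P q) +P r) ≋ (p +P (q +P r))
  +-assoc p q r = mk≋ λ m → cong (λ z → coeff z m) (LP.++-assoc p q r)

  +-comm : ∀ p q → (p +P q) ≋ (q +P p)
  +-comm p q = mk≋ λ m →
    trans (coeff-++ p q m) (trans (ℤP.+-comm (coeff p m) (coeff q m)) (sym (coeff-++ q p m)))

  +-idˡ : ∀ p → (0P +P p) ≋ p
  +-idˡ p = mk≋ λ m → refl

  +-idʳ : ∀ p → (p +P 0P) ≋ p
  +-idʳ p = mk≋ λ m → cong (λ z → coeff z m) (LP.++-identityʳ p)

  -‿cong : ∀ {p q} → p ≋ q → (-P p) ≋ (-P q)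
  -‿cong {p} {q} (mk≋ e) = mk≋ λ m →
    trans (coeff-· (- + 1) p m) (trans (cong ((- + 1) ℤ.*_) (e m)) (sym (coeff-· (- + 1) q m)))

  -‿invˡ : ∀ p → ((-P p) +P p) ≋ 0P
  -‿invˡ p = mk≋ λ m → trans (coeff-++ (-P p) p m) (trans (cong (ℤ._+ coeff p m) (coeff-· (- + 1) p m))
    (solve 1 (λ a → (:- con (+ 1)) :* a :+ a := con (+ 0)) refl (coeff p m)))
    where open ℤ-Solver.+-*-Solver

  -‿invʳ : ∀ p → (p +P (-P p)) ≋ 0P
  -‿invʳ p = ≋-trans (+-comm p (-P p)) (-‿invˡ p)

  -- Multiplication: the coefficient of m in p·q is a double sum; mulInner m q m₁
  -- is the coefficient of m in m₁·q.
  mulInner : Mon → Poly → Mon → ℤ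
  mulInner m q m₁ = linExt (λ m₂ → δ m (mulMon m₁ m₂)) q

  coeff-* : ∀ p q m → coeff (p *P q) m ≡ linExt (mulInner m q) p
  coeff-* p q m = trans (coeff-linExt (p *P q) m) (linExt-* (δ m) p q)

  δ-mulMon-invariant : ∀ m m₁ → Invariant (λ m₂ → δ m (mulMon m₁ m₂))
  δ-mulMon-invariant m m₁ e = δ-invariant m (mulMon-resp (∼-refl m₁) e)

  mulInner-invariant : ∀ m q → Invariant (mulInner m q)
  mulInner-invariant m q {m₁} {m₁'} e = linExt-ext q (λ m₂ → δ-invariant m (mulMon-resp e (∼-refl m₂)))

  *-cong : ∀ {p p' q q'} → p ≋ p' → q ≋ q' → (p *P q) ≋ (p' *P q')
  *-cong {p} {p'} {q} {q'} (mk≋ e) (mk≋ f) = mk≋ λ m → begin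
      coeff (p *P q) m
    ≡⟨ coeff-* p q m ⟩
      linExt (mulInner m q) p
    ≡⟨ linExt-ext p (λ m₁ → linExt-≈ _ (δ-mulMon-invariant m m₁) q q' f) ⟩
      linExt (mulInner m q') p
    ≡⟨ linExt-≈ _ (mulInner-invariant m q') p p' e ⟩
      linExt (mulInner m q') p'
    ≡⟨ sym (coeff-* p' q' m) ⟩
      coeff (p' *P q') m ∎
    where open ≡-Reasoning

  *-comm : ∀ p q → (p *P q) ≋ (q *P p)
  *-comm p q = mk≋ λ m → begin
      coeff (p *P q) m
    ≡⟨ coeff-* p q m ⟩
      linExt (λ m₁ → linExt (λ m₂ → δ m (mulMon m₁ m₂)) q) p
    ≡⟨ linExt-swap (λ m₁ m₂ → δ m (mulMon m₁ m₂)) p q ⟩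
      linExt (λ m₂ → linExt (λ m₁ → δ m (mulMon m₁ m₂)) p) q
    ≡⟨ linExt-ext q (λ m₂ → linExt-ext p (λ m₁ → cong (δ m) (mulMon-comm m₁ m₂))) ⟩
      linExt (mulInner m p) q
    ≡⟨ sym (coeff-* q p m) ⟩
      coeff (q *P p) m ∎
    where open ≡-Reasoning

  *-assoc : ∀ p q r → ((p *P q) *P r) ≋ (p *P (q *P r))
  *-assoc p q r = mk≋ λ m → begin
      coeff ((p *P q) *P r) m
    ≡⟨ coeff-* (p *P q) r m ⟩
      linExt (mulInner m r) (p *P q)
    ≡⟨ linExt-* (mulInner m r) p q ⟩
      linExt (λ m₁ → linExt (λ m₂ → mulInner m r (mulMon m₁ m₂)) q) p
    ≡⟨ linExt-ext p (λ m₁ → linExt-ext q (λ m₂ → linExt-ext r (λ m₃ → cong (δ m) (mulMon-assoc m₁ m₂ m₃)))) ⟩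
      linExt (λ m₁ → linExt (λ m₂ → linExt (λ m₃ → δ m (mulMon m₁ (mulMon m₂ m₃))) r) q) p
    ≡⟨ linExt-ext p (λ m₁ → sym (linExt-* (λ m₂₃ → δ m (mulMon m₁ m₂₃)) q r)) ⟩
      linExt (mulInner m (q *P r)) p
    ≡⟨ sym (coeff-* p (q *P r) m) ⟩
      coeff (p *P (q *P r)) m ∎
    where open ≡-Reasoning

  *-idˡ : ∀ p → (1P *P p) ≋ p
  *-idˡ p = mk≋ λ m → begin
      coeff (1P *P p) m
    ≡⟨ coeff-* 1P p m ⟩
      + 1 ℤ.* mulInner m p (+ 0 , []) ℤ.+ + 0
    ≡⟨ trans (ℤP.+-identityʳ _) (ℤP.*-identityˡ _) ⟩
      mulInner m p (+ 0 , [])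
    ≡⟨ linExt-ext p (λ m₂ → cong (δ m) (mulMon-identityˡ m₂)) ⟩
      linExt (δ m) p
    ≡⟨ sym (coeff-linExt p m) ⟩
      coeff p m ∎
    where open ≡-Reasoning

  *-idʳ : ∀ p → (p *P 1P) ≋ p
  *-idʳ p = ≋-trans (*-comm p 1P) (*-idˡ p)

  distribˡ : ∀ p q r → (p *P (q +P r)) ≋ ((p *P q) +P (p *P r))
  distribˡ p q r = mk≋ λ m → begin
      coeff (p *P (q +P r)) m
    ≡⟨ coeff-* p (q ++ r) m ⟩
      linExt (mulInner m (q ++ r)) p
    ≡⟨ linExt-ext p (λ m₁ → linExt-++ _ q r) ⟩
      linExt (λ m₁ → mulInner m q m₁ ℤ.+ mulInner m r m₁) p
    ≡⟨ linExt-+ _ _ p ⟩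
      linExt (mulInner m q) p ℤ.+ linExt (mulInner m r) p
    ≡⟨ sym (cong₂ ℤ._+_ (coeff-* p q m) (coeff-* p r m)) ⟩
      coeff (p *P q) m ℤ.+ coeff (p *P r) m
    ≡⟨ sym (coeff-++ (p *P q) (p *P r) m) ⟩
      coeff ((p *P q) +P (p *P r)) m ∎
    where open ≡-Reasoning

  distribʳ : ∀ p q r → ((q +P r) *P p) ≋ ((q *P p) +P (r *P p))
  distribʳ p q r = ≋-trans (*-comm (q +P r) p) (≋-trans (distribˡ p q r) (+-cong (*-comm p q) (*-comm p r)))

  PolySetoid : Setoid _ _
  PolySetoid = record { Carrier = Poly ; _≈_ = _≋_ ; isEquivalence = ≋-isEquivalence }
    where
    ≋-isEquivalence : IsEquivalence _≋_
    ≋-isEquivalence = record { refl = ≋-refl ; sym = ≋-sym ; trans = ≋-trans }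

  PolyRing : CommutativeRing _ _
  PolyRing = record
    { Carrier = Poly ; _≈_ = _≋_ ; _+_ = _+P_ ; _*_ = _*P_ ; -_ = -P_ ; 0# = 0P ; 1# = 1P
    ; isCommutativeRing = record
      { isRing = record
        { +-isAbelianGroup = record
          { isGroup = record
            { isMonoid = record
              { isSemigroup = record
                { isMagma = record { isEquivalence = Setoid.isEquivalence PolySetoid ; ∙-cong = +-cong }
                ; assoc = +-assoc }
              ; identity = +-idˡ , +-idʳ }
            ; inverse = -‿invˡ , -‿invʳ
            ; ⁻¹-cong = -‿cong }
          ; comm = +-comm }
        ; *-cong = *-cong
        ; *-assoc = *-assoc
        ; *-identity = *-idˡ , *-idʳ
        ; distrib = distribˡ , distribʳ }
      ; *-comm = *-comm } }

  *-zeroʳ : ∀ p → p *P 0P ≋ 0P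
  *-zeroʳ p = mk≋ λ m → trans (coeff-* p [] m) (linExt-0 p)

  scalar : ℤ → Poly
  scalar a = a ·P 1P

  ·-scalar : ∀ a p → a ·P p ≋ scalar a *P p
  ·-scalar a p = mk≋ λ m → trans (coeff-· a p m) (sym (begin
      coeff (scalar a *P p) m
    ≡⟨ coeff-* (scalar a) p m ⟩
      a ℤ.* + 1 ℤ.* mulInner m p (+ 0 , []) ℤ.+ + 0
    ≡⟨ trans (ℤP.+-identityʳ _) (cong (ℤ._* mulInner m p (+ 0 , [])) (ℤP.*-identityʳ a)) ⟩
      a ℤ.* mulInner m p (+ 0 , [])
    ≡⟨ cong (a ℤ.*_) (linExt-ext p (λ m₂ → cong (δ m) (mulMon-identityˡ m₂))) ⟩
      a ℤ.* linExt (δ m) p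
    ≡⟨ cong (a ℤ.*_) (sym (coeff-linExt p m)) ⟩
      a ℤ.* coeff p m ∎))
    where open ≡-Reasoning

  ·-cong : ∀ a {p q} → p ≋ q → a ·P p ≋ a ·P q
  ·-cong a {p} {q} (mk≋ e) = mk≋ λ m →
    trans (coeff-· a p m) (trans (cong (a ℤ.*_) (e m)) (sym (coeff-· a q m)))

  ·-+ : ∀ a b p → (a ℤ.+ b) ·P p ≋ (a ·P p) +P (b ·P p)
  ·-+ a b p = mk≋ λ m → trans (coeff-· (a ℤ.+ b) p m) (trans (ℤP.*-distribʳ-+ (coeff p m) a b)
    (sym (trans (coeff-++ (a ·P p) (b ·P p) m) (cong₂ ℤ._+_ (coeff-· a p m) (coeff-· b p m)))))

  ·-1 : ∀ p → + 1 ·P p ≋ p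
  ·-1 p = mk≋ λ m → trans (coeff-· (+ 1) p m) (ℤP.*-identityˡ _)

  ·-0 : ∀ p → + 0 ·P p ≋ 0P
  ·-0 p = mk≋ λ m → trans (coeff-· (+ 0) p m) (ℤP.*-zeroˡ (coeff p m))

  ·-distr : ∀ a p q → a ·P (p +P q) ≋ (a ·P p) +P (a ·P q)
  ·-distr a p q = mk≋ λ m → trans (coeff-· a (p +P q) m) (trans (cong (a ℤ.*_) (coeff-++ p q m))
    (trans (ℤP.*-distribˡ-+ a (coeff p m) (coeff q m))
    (sym (trans (coeff-++ (a ·P p) (a ·P q) m) (cong₂ ℤ._+_ (coeff-· a p m) (coeff-· a q m))))))

  -- scalar is a ring homomorphism, so it can interpret constants in the solver.
  scalar-+ : ∀ x y → scalar (x ℤ.+ y) ≋ scalar x +P scalar y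
  scalar-+ x y = ·-+ x y 1P

  scalar-* : ∀ x y → scalar (x ℤ.* y) ≋ scalar x *P scalar y
  scalar-* x y = ≋-trans (mk≋ λ m → begin
      coeff (scalar (x ℤ.* y)) m    ≡⟨ coeff-· (x ℤ.* y) 1P m ⟩
      x ℤ.* y ℤ.* coeff 1P m        ≡⟨ ℤP.*-assoc x y (coeff 1P m) ⟩
      x ℤ.* (y ℤ.* coeff 1P m)      ≡⟨ cong (x ℤ.*_) (sym (coeff-· y 1P m)) ⟩
      x ℤ.* coeff (scalar y) m      ≡⟨ sym (coeff-· x (scalar y) m) ⟩
      coeff (x ·P scalar y) m       ∎) (·-scalar x (scalar y))
    where open ≡-Reasoning

  scalar-neg : ∀ x → scalar (ℤ.- x) ≋ -P scalar x
  scalar-neg x = mk≋ λ m → begin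
      coeff (scalar (ℤ.- x)) m        ≡⟨ coeff-· (ℤ.- x) 1P m ⟩
      ℤ.- x ℤ.* coeff 1P m            ≡⟨ cong (ℤ._* coeff 1P m) (sym (ℤP.-1*i≡-i x)) ⟩
      - + 1 ℤ.* x ℤ.* coeff 1P m      ≡⟨ ℤP.*-assoc (- + 1) x (coeff 1P m) ⟩
      - + 1 ℤ.* (x ℤ.* coeff 1P m)    ≡⟨ cong (- + 1 ℤ.*_) (sym (coeff-· x 1P m)) ⟩
      - + 1 ℤ.* coeff (scalar x) m    ≡⟨ sym (coeff-· (- + 1) (scalar x) m) ⟩
      coeff (-P scalar x) m           ∎
    where open ≡-Reasoning

  scalarHom : ACR._-Raw-AlmostCommutative⟶_ (CommutativeRing.rawRing ℤP.+-*-commutativeRing)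
                                             (ACR.fromCommutativeRing PolyRing)
  scalarHom = record { ⟦_⟧ = scalar ; +-homo = scalar-+ ; *-homo = scalar-* ; -‿homo = scalar-neg
                     ; 0-homo = ·-0 1P ; 1-homo = ·-1 1P }

  scalar≟ : ∀ x y → Maybe (scalar x ≋ scalar y)
  scalar≟ x y with x ℤ.≟ y
  ... | yes refl = just ≋-refl
  ... | no _     = nothing

  -- The ring solver for R with integer constants: `con c` denotes scalar c.
  module R-Solver = RingSolver (CommutativeRing.rawRing ℤP.+-*-commutativeRing)
    (ACR.fromCommutativeRing PolyRing) scalarHom scalar≟

  Σ< : ℕ → (ℕ → Poly) → Poly
  Σ< zero    f = 0P
  Σ< (suc n) f = Σ< n f +P f n

  ΣP≡Σ< : ∀ n f → ΣP n f ≡ Σ< n (λ i → f (suc i))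
  ΣP≡Σ< zero    f = refl
  ΣP≡Σ< (suc n) f = cong (_+P f (suc n)) (ΣP≡Σ< n f)

  Σ<-cong : ∀ n {f g} → (∀ i → i ℕ.< n → f i ≋ g i) → Σ< n f ≋ Σ< n g
  Σ<-cong zero h = ≋-refl
  Σ<-cong (suc n) h = +-cong (Σ<-cong n (λ i lt → h i (ℕP.m≤n⇒m≤1+n lt))) (h n ℕP.≤-refl)

  Σ<-+ : ∀ n f g → Σ< n (λ i → f i +P g i) ≋ Σ< n f +P Σ< n g
  Σ<-+ zero f g = ≋-refl
  Σ<-+ (suc n) f g = ≋-trans (+-cong (Σ<-+ n f g) ≋-refl)
    (solve 4 (λ a b c d → (a :+ b) :+ (c :+ d) := (a :+ c) :+ (b :+ d)) ≋-refl (Σ< n f) (Σ< n g) (f n) (g n))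
    where open R-Solver

  Σ<-shift : ∀ n f → Σ< (suc n) f ≋ f 0 +P Σ< n (λ i → f (suc i))
  Σ<-shift zero f = ≋-sym (+-idʳ (f 0))
  Σ<-shift (suc n) f = ≋-trans (+-cong (Σ<-shift n f) ≋-refl) (+-assoc (f 0) _ _)

  Σ<-0 : ∀ n f → (∀ i → i ℕ.< n → f i ≋ 0P) → Σ< n f ≋ 0P
  Σ<-0 zero f h = ≋-refl
  Σ<-0 (suc n) f h = ≋-trans (+-cong (Σ<-0 n f (λ i lt → h i (ℕP.m≤n⇒m≤1+n lt))) (h n ℕP.≤-refl)) (+-idˡ 0P)

  Σ<-*r : ∀ n f q → Σ< n f *P q ≋ Σ< n (λ i → f i *P q)
  Σ<-*r zero f q = mk≋ λ m → refl
  Σ<-*r (suc n) f q = ≋-trans (distribʳ q (Σ< n f) (f n)) (+-cong (Σ<-*r n f q) ≋-refl)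

  Σ<-*l : ∀ n p f → p *P Σ< n f ≋ Σ< n (λ i → p *P f i)
  Σ<-*l n p f = ≋-trans (*-comm p (Σ< n f)) (≋-trans (Σ<-*r n f p) (Σ<-cong n (λ i _ → *-comm (f i) p)))

  Σ<-· : ∀ n a f → a ·P Σ< n f ≋ Σ< n (λ i → a ·P f i)
  Σ<-· zero a f = ≋-refl
  Σ<-· (suc n) a f = ≋-trans (·-distr a (Σ< n f) (f n)) (+-cong (Σ<-· n a f) ≋-refl)

  Σ<-extend : ∀ n f M → n ℕ.≤ M → (∀ i → n ℕ.≤ i → i ℕ.< M → f i ≋ 0P) → Σ< n f ≋ Σ< M f
  Σ<-extend n f zero    ℕ.z≤n h = ≋-refl
  Σ<-extend n f (suc M) le    h with ℕP.m≤n⇒m<n∨m≡n le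
  ... | inj₂ refl        = ≋-refl
  ... | inj₁ (ℕ.s≤s n≤M) = ≋-sym (≋-trans
    (+-cong (≋-sym (Σ<-extend n f M n≤M (λ i l₁ l₂ → h i l₁ (ℕP.m≤n⇒m≤1+n l₂)))) (h M n≤M ℕP.≤-refl))
    (+-idʳ (Σ< n f)))


-- The partial derivatives ∂ⱼ of Defs and the operator
--   D N = Σ_{j=1}^{N} X_{j+1} ∂ⱼ ,
-- which drives the recursion for S_{n,k}.  On a monomial, ∂ⱼ multiplies by
-- the exponent of Xⱼ (expOf) and lowers that exponent by one (lowered); this
-- yields the Leibniz rule, so D N is a derivation of R.  A support
-- argument shows that D N p does not depend on N once N exceeds the largest
-- index of a variable occurring in p (D-extend).
module Derivation where

  open import Defs
  open Monomials
  open Linear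
  open Ring
  open import Data.Nat as ℕ using (ℕ; zero; suc; _∸_)
  import Data.Nat.Properties as ℕP
  open import Data.Integer as ℤ using (ℤ; +_; -_)
  import Data.Integer.Properties as ℤP
  import Data.Integer.Solver as ℤ-Solver
  open import Data.List using ([]; _∷_)
  import Data.List.Properties as LP
  open import Data.Product using (_,_)
  open import Data.Empty using (⊥; ⊥-elim)
  open import Relation.Binary.PropositionalEquality
  open import Relation.Nullary using (yes; no)

  -- ∂ (suc j) acts on X_{j+1}; expOf j m is the exponent of X_{j+1} in m.
  expOf : ℕ → Mon → ℤ
  expOf zero    (e , r) = e
  expOf (suc i) (e , r) = + lookupE r i

  lowered : ℕ → Mon → Mon
  lowered zero    (e , r) = (e ℤ.- + 1 , r)
  lowered (suc i) (e , r) = (e , decE r i)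

  linExt-∂ : ∀ j g p → linExt g (∂ (suc j) p) ≡ linExt (λ m → expOf j m ℤ.* g (lowered j m)) p
  linExt-∂ zero    g []              = refl
  linExt-∂ (suc i) g []              = refl
  linExt-∂ zero    g ((c , m) ∷ p)   =
    cong₂ ℤ._+_ (ℤP.*-assoc c (expOf zero m) _) (linExt-∂ zero g p)
  linExt-∂ (suc i) g ((c , m) ∷ p)   =
    cong₂ ℤ._+_ (ℤP.*-assoc c (expOf (suc i) m) _) (linExt-∂ (suc i) g p)

  coeff-∂ : ∀ j p m → coeff (∂ (suc j) p) m ≡ linExt (λ m' → expOf j m' ℤ.* δ m (lowered j m')) p
  coeff-∂ j p m = trans (coeff-linExt (∂ (suc j) p) m) (linExt-∂ j (δ m) p)

  lookup-decE-resp : ∀ r s i → (∀ k → lookupE r k ≡ lookupE s k) →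
    ∀ k → lookupE (decE r i) k ≡ lookupE (decE s i) k
  lookup-decE-resp r s i h k with i ℕP.≟ k
  ... | yes refl = trans (lookup-decE-same r i) (trans (cong (_∸ 1) (h i)) (sym (lookup-decE-same s i)))
  ... | no i≢k   = trans (lookup-decE-other r i k i≢k) (trans (h k) (sym (lookup-decE-other s i k i≢k)))

  expOf-invariant : ∀ j {m m'} → m ∼ m' → expOf j m ≡ expOf j m'
  expOf-invariant zero    e = fstEq (∼⇒MonEq e)
  expOf-invariant (suc i) e = cong +_ (lkEq (∼⇒MonEq e) i)

  lowered-invariant : ∀ j {m m'} → m ∼ m' → lowered j m ∼ lowered j m'
  lowered-invariant zero    {e , r} {e' , r'} eq =
    MonEq⇒∼ (meq (cong (ℤ._+ (- + 1)) (fstEq (∼⇒MonEq eq))) (lkEq (∼⇒MonEq eq)))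
  lowered-invariant (suc i) {e , r} {e' , r'} eq =
    MonEq⇒∼ (meq (fstEq (∼⇒MonEq eq)) (lookup-decE-resp r r' i (lkEq (∼⇒MonEq eq))))

  ∂-cong : ∀ j {p q} → p ≋ q → ∂ (suc j) p ≋ ∂ (suc j) q
  ∂-cong j {p} {q} (mk≋ e) = mk≋ λ m →
    trans (coeff-∂ j p m) (trans (linExt-≈ _ (kernel-invariant m) p q e) (sym (coeff-∂ j q m)))
    where
    kernel-invariant : ∀ m → Invariant (λ m' → expOf j m' ℤ.* δ m (lowered j m'))
    kernel-invariant m eq = cong₂ ℤ._*_ (expOf-invariant j eq) (δ-invariant m (lowered-invariant j eq))

  ∂-+ : ∀ j p q → ∂ j (p +P q) ≡ ∂ j p +P ∂ j q
  ∂-+ zero          p q = refl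
  ∂-+ (suc zero)    p q = LP.map-++ _ p q
  ∂-+ (suc (suc i)) p q = LP.map-++ _ p q

  ∂-· : ∀ j a p → ∂ (suc j) (a ·P p) ≋ a ·P ∂ (suc j) p
  ∂-· j a p = mk≋ λ m → begin
      coeff (∂ (suc j) (a ·P p)) m
    ≡⟨ coeff-∂ j (a ·P p) m ⟩
      linExt (λ m' → expOf j m' ℤ.* δ m (lowered j m')) (a ·P p)
    ≡⟨ linExt-· a _ p ⟩
      a ℤ.* linExt (λ m' → expOf j m' ℤ.* δ m (lowered j m')) p
    ≡⟨ cong (a ℤ.*_) (sym (coeff-∂ j p m)) ⟩
      a ℤ.* coeff (∂ (suc j) p) m
    ≡⟨ sym (coeff-· a (∂ (suc j) p) m) ⟩
      coeff (a ·P ∂ (suc j) p) m ∎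
    where open ≡-Reasoning

  ∂-0 : ∀ j → ∂ j [] ≡ []
  ∂-0 zero          = refl
  ∂-0 (suc zero)    = refl
  ∂-0 (suc (suc i)) = refl

  expOf-mulMon : ∀ j m₁ m₂ → expOf j (mulMon m₁ m₂) ≡ expOf j m₁ ℤ.+ expOf j m₂
  expOf-mulMon zero    (e , r) (e' , r') = refl
  expOf-mulMon (suc i) (e , r) (e' , r') = cong +_ (lookup-add r r' i)

  lowered-mulMonˡ : ∀ j m₁ m₂ → (expOf j m₁ ≡ + 0 → ⊥) →
    lowered j (mulMon m₁ m₂) ∼ mulMon (lowered j m₁) m₂
  lowered-mulMonˡ zero (e , r) (e' , r') _ = MonEq⇒∼ (meq
    (solve 2 (λ a b → a :+ b :- con (+ 1) := a :- con (+ 1) :+ b) refl e e') (λ k → refl))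
    where open ℤ-Solver.+-*-Solver
  lowered-mulMonˡ (suc i) (e , r) (e' , r') nz = MonEq⇒∼ (meq refl lk)
    where
    pos : 1 ℕ.≤ lookupE r i
    pos with lookupE r i
    ... | zero  = ⊥-elim (nz refl)
    ... | suc _ = ℕ.s≤s ℕ.z≤n
    lk : ∀ k → lookupE (decE (addExps r r') i) k ≡ lookupE (addExps (decE r i) r') k
    lk k with i ℕP.≟ k
    ... | yes refl = begin
        lookupE (decE (addExps r r') i) i      ≡⟨ lookup-decE-same (addExps r r') i ⟩
        lookupE (addExps r r') i ∸ 1           ≡⟨ cong (_∸ 1) (lookup-add r r' i) ⟩
        lookupE r i ℕ.+ lookupE r' i ∸ 1       ≡⟨ ℕP.+-∸-comm (lookupE r' i) pos ⟩
        lookupE r i ∸ 1 ℕ.+ lookupE r' i       ≡⟨ cong (ℕ._+ lookupE r' i) (sym (lookup-decE-same r i)) ⟩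
        lookupE (decE r i) i ℕ.+ lookupE r' i  ≡⟨ sym (lookup-add (decE r i) r' i) ⟩
        lookupE (addExps (decE r i) r') i      ∎
      where open ≡-Reasoning
    ... | no i≢k = begin
        lookupE (decE (addExps r r') i) k      ≡⟨ lookup-decE-other (addExps r r') i k i≢k ⟩
        lookupE (addExps r r') k               ≡⟨ lookup-add r r' k ⟩
        lookupE r k ℕ.+ lookupE r' k           ≡⟨ cong (ℕ._+ lookupE r' k) (sym (lookup-decE-other r i k i≢k)) ⟩
        lookupE (decE r i) k ℕ.+ lookupE r' k  ≡⟨ sym (lookup-add (decE r i) r' k) ⟩
        lookupE (addExps (decE r i) r') k      ∎
      where open ≡-Reasoning

  lowered-mulMonʳ : ∀ j m₁ m₂ → (expOf j m₂ ≡ + 0 → ⊥) →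
    lowered j (mulMon m₁ m₂) ∼ mulMon m₁ (lowered j m₂)
  lowered-mulMonʳ j m₁ m₂ nz =
    subst₂ _∼_ (cong (lowered j) (mulMon-comm m₂ m₁)) (mulMon-comm (lowered j m₂) m₁) (lowered-mulMonˡ j m₂ m₁ nz)

  -- The Leibniz rule on a pair of monomials (a factor with exponent 0
  -- contributes nothing, so the side conditions above are harmless).
  leibniz-monomial : ∀ j m m₁ m₂ →
    expOf j (mulMon m₁ m₂) ℤ.* δ m (lowered j (mulMon m₁ m₂))
    ≡ expOf j m₁ ℤ.* δ m (mulMon (lowered j m₁) m₂) ℤ.+ expOf j m₂ ℤ.* δ m (mulMon m₁ (lowered j m₂))
  leibniz-monomial j m m₁ m₂ rewrite expOf-mulMon j m₁ m₂ with expOf j m₁ ℤ.≟ + 0 | expOf j m₂ ℤ.≟ + 0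
  ... | yes a | yes b rewrite a | b = refl
  ... | no a  | yes b rewrite b =
    trans (cong₂ ℤ._*_ (ℤP.+-identityʳ (expOf j m₁)) (δ-invariant m (lowered-mulMonˡ j m₁ m₂ a)))
          (sym (ℤP.+-identityʳ _))
  ... | yes a | no b  rewrite a =
    trans (cong₂ ℤ._*_ (ℤP.+-identityˡ (expOf j m₂)) (δ-invariant m (lowered-mulMonʳ j m₁ m₂ b)))
          (sym (trans (cong (ℤ._+ (expOf j m₂ ℤ.* δ m (mulMon m₁ (lowered j m₂))))
                            (ℤP.*-zeroˡ (δ m (mulMon (lowered j m₁) m₂))))
                      (ℤP.+-identityˡ _)))
  ... | no a  | no b  =
    trans (ℤP.*-distribʳ-+ (δ m (lowered j (mulMon m₁ m₂))) (expOf j m₁) (expOf j m₂))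
          (cong₂ ℤ._+_ (cong (expOf j m₁ ℤ.*_) (δ-invariant m (lowered-mulMonˡ j m₁ m₂ a)))
                       (cong (expOf j m₂ ℤ.*_) (δ-invariant m (lowered-mulMonʳ j m₁ m₂ b))))

  leibniz : ∀ j p q → ∂ (suc j) (p *P q) ≋ (∂ (suc j) p *P q) +P (p *P ∂ (suc j) q)
  leibniz j p q = mk≋ λ m → begin
      coeff (∂ (suc j) (p *P q)) m
    ≡⟨ coeff-∂ j (p *P q) m ⟩
      linExt (λ m' → expOf j m' ℤ.* δ m (lowered j m')) (p *P q)
    ≡⟨ linExt-* _ p q ⟩
      linExt (λ m₁ → linExt (λ m₂ → expOf j (mulMon m₁ m₂) ℤ.* δ m (lowered j (mulMon m₁ m₂))) q) p
    ≡⟨ linExt-ext p (λ m₁ → linExt-ext q (λ m₂ → leibniz-monomial j m m₁ m₂)) ⟩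
      linExt (λ m₁ → linExt (λ m₂ → expOf j m₁ ℤ.* δ m (mulMon (lowered j m₁) m₂)
                                   ℤ.+ expOf j m₂ ℤ.* δ m (mulMon m₁ (lowered j m₂))) q) p
    ≡⟨ linExt-ext p (λ m₁ → trans (linExt-+ _ _ q)
                      (cong₂ ℤ._+_ (linExt-scale (expOf j m₁) _ q) (sym (linExt-∂ j _ q)))) ⟩
      linExt (λ m₁ → expOf j m₁ ℤ.* mulInner m q (lowered j m₁) ℤ.+ mulInner m (∂ (suc j) q) m₁) p
    ≡⟨ linExt-+ _ _ p ⟩
      linExt (λ m₁ → expOf j m₁ ℤ.* mulInner m q (lowered j m₁)) p ℤ.+ linExt (mulInner m (∂ (suc j) q)) p
    ≡⟨ cong₂ ℤ._+_ (sym (trans (coeff-* (∂ (suc j) p) q m) (linExt-∂ j _ p))) (sym (coeff-* p (∂ (suc j) q) m)) ⟩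
      coeff (∂ (suc j) p *P q) m ℤ.+ coeff (p *P ∂ (suc j) q) m
    ≡⟨ sym (coeff-++ (∂ (suc j) p *P q) _ m) ⟩
      coeff ((∂ (suc j) p *P q) +P (p *P ∂ (suc j) q)) m ∎
    where open ≡-Reasoning

  Dterm : ℕ → Poly → Poly
  Dterm i p = X (suc (suc i)) *P ∂ (suc i) p

  D : ℕ → Poly → Poly
  D N p = Σ< N (λ i → Dterm i p)

  ΣP≡D : ∀ N p → ΣP N (λ j → X (suc j) *P ∂ j p) ≡ D N p
  ΣP≡D N p = ΣP≡Σ< N (λ j → X (suc j) *P ∂ j p)

  D-cong : ∀ N {p q} → p ≋ q → D N p ≋ D N q
  D-cong N e = Σ<-cong N (λ i _ → *-cong (≋-refl {X (suc (suc i))}) (∂-cong i e))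

  D-0 : ∀ N → D N 0P ≋ 0P
  D-0 N = Σ<-0 N _ (λ i _ → subst (λ z → X (suc (suc i)) *P z ≋ 0P) (sym (∂-0 (suc i))) (*-zeroʳ (X (suc (suc i)))))

  D-+ : ∀ N p q → D N (p +P q) ≋ D N p +P D N q
  D-+ N p q = ≋-trans (Σ<-cong N term-+) (Σ<-+ N (λ i → Dterm i p) (λ i → Dterm i q))
    where
    term-+ : ∀ i → i ℕ.< N → Dterm i (p +P q) ≋ Dterm i p +P Dterm i q
    term-+ i _ = ≋-trans (*-cong (≋-refl {X (suc (suc i))}) (≡⇒≋ (∂-+ (suc i) p q)))
                         (distribˡ (X (suc (suc i))) (∂ (suc i) p) (∂ (suc i) q))

  D-· : ∀ N a p → D N (a ·P p) ≋ a ·P D N p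
  D-· N a p = ≋-trans (Σ<-cong N term-·) (≋-sym (Σ<-· N a (λ i → Dterm i p)))
    where
    open R-Solver
    term-· : ∀ i → i ℕ.< N → Dterm i (a ·P p) ≋ a ·P Dterm i p
    term-· i _ = ≋-trans (*-cong (≋-refl {X (suc (suc i))}) (≋-trans (∂-· i a p) (·-scalar a (∂ (suc i) p))))
      (≋-trans (solve 3 (λ x k d → x :* (k :* d) := k :* (x :* d)) ≋-refl (X (suc (suc i))) (scalar a) (∂ (suc i) p))
               (≋-sym (·-scalar a (Dterm i p))))

  D-* : ∀ N p q → D N (p *P q) ≋ (D N p *P q) +P (p *P D N q)
  D-* N p q =
    ≋-trans (Σ<-cong N term-*)
      (≋-trans (Σ<-+ N (λ i → Dterm i p *P q) (λ i → p *P Dterm i q))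
        (+-cong (≋-sym (Σ<-*r N (λ i → Dterm i p) q)) (≋-sym (Σ<-*l N p (λ i → Dterm i q)))))
    where
    open R-Solver
    term-* : ∀ i → i ℕ.< N → Dterm i (p *P q) ≋ Dterm i p *P q +P p *P Dterm i q
    term-* i _ = ≋-trans (*-cong (≋-refl {X (suc (suc i))}) (leibniz i p q))
      (solve 5 (λ x a b c d → x :* (a :* b :+ c :* d) := x :* a :* b :+ c :* (x :* d))
         ≋-refl (X (suc (suc i))) (∂ (suc i) p) q p (∂ (suc i) q))

  D-Σ< : ∀ N n f → D N (Σ< n f) ≋ Σ< n (λ i → D N (f i))
  D-Σ< N zero    f = D-0 N
  D-Σ< N (suc n) f = ≋-trans (D-+ N (Σ< n f) (f n)) (+-cong (D-Σ< N n f) ≋-refl)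


-- Supported N p: only the variables X₁, …, X_N occur in p.  Such p is
-- killed by ∂ⱼ for j > N, hence D N p ≋ D M p for all M ≥ N (D-extend).
module Support where

  open import Defs
  open Monomials
  open Linear
  open Ring
  open Derivation
  open import Data.Nat as ℕ using (ℕ; zero; suc; _∸_; _≤_; z≤n; s≤s)
  import Data.Nat.Properties as ℕP
  open import Data.Integer as ℤ using (+_)
  import Data.Integer.Properties as ℤP
  open import Data.List using ([]; _∷_)
  import Data.List.Properties as LP
  open import Data.List.Relation.Unary.All using (All; []; _∷_)
  import Data.List.Relation.Unary.All.Properties as AllP
  open import Data.Product using (_,_; proj₂)
  open import Data.Sum using (inj₁; inj₂)
  open import Relation.Binary.PropositionalEquality

  -- The exponent of X_{i+2} is 0 whenever i + 2 > N.
  OnlyVars : ℕ → Mon → Set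
  OnlyVars N (e , r) = ∀ i → N ≤ suc i → lookupE r i ≡ 0

  Supported : ℕ → Poly → Set
  Supported N p = All (λ t → OnlyVars N (proj₂ t)) p

  Supported-mono : ∀ {N N'} p → N ≤ N' → Supported N p → Supported N' p
  Supported-mono []                  le []      = []
  Supported-mono ((c , (e , r)) ∷ p) le (f ∷ s) = (λ i l → f i (ℕP.≤-trans le l)) ∷ Supported-mono p le s

  Supported-· : ∀ {N} a p → Supported N p → Supported N (a ·P p)
  Supported-· a []                  []      = []
  Supported-· a ((c , (e , r)) ∷ p) (f ∷ s) = f ∷ Supported-· a p s

  Supported-* : ∀ {N} p q → Supported N p → Supported N q → Supported N (p *P q)
  Supported-* []                  q []       sq = []
  Supported-* ((c , (e , r)) ∷ p) q (f ∷ sp) sq =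
    AllP.++⁺ (subst (Supported _) (LP.++-identityʳ _) (row q sq)) (Supported-* p q sp sq)
    where
    row : ∀ q → Supported _ q → Supported _ (((c , (e , r)) ∷ []) *P q)
    row []                    []      = []
    row ((d , (e' , r')) ∷ q) (g ∷ s) = (λ i l → trans (lookup-add r r' i) (cong₂ ℕ._+_ (f i l) (g i l))) ∷ row q s

  lookup-decE-0 : ∀ r i k → lookupE r k ≡ 0 → lookupE (decE r i) k ≡ 0
  lookup-decE-0 []      i       k       e = refl
  lookup-decE-0 (x ∷ r) zero    zero    e = cong (_∸ 1) e
  lookup-decE-0 (x ∷ r) zero    (suc k) e = e
  lookup-decE-0 (x ∷ r) (suc i) zero    e = e
  lookup-decE-0 (x ∷ r) (suc i) (suc k) e = lookup-decE-0 r i k e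

  Supported-∂ : ∀ {N} j p → Supported N p → Supported N (∂ j p)
  Supported-∂ zero          p                   s       = []
  Supported-∂ (suc zero)    []                  []      = []
  Supported-∂ (suc zero)    ((c , (e , r)) ∷ p) (f ∷ s) = f ∷ Supported-∂ (suc zero) p s
  Supported-∂ (suc (suc i)) []                  []      = []
  Supported-∂ (suc (suc i)) ((c , (e , r)) ∷ p) (f ∷ s) =
    (λ k l → lookup-decE-0 r i k (f k l)) ∷ Supported-∂ (suc (suc i)) p s

  Supported-X₁^ : ∀ {N} a → Supported N (X₁^ a)
  Supported-X₁^ a = (λ i l → refl) ∷ []

  lookup-unitExps-above : ∀ i k → i ℕ.< k → lookupE (unitExps i) k ≡ 0
  lookup-unitExps-above zero    (suc zero)    l       = refl
  lookup-unitExps-above zero    (suc (suc k)) l       = refl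
  lookup-unitExps-above (suc i) (suc k)       (s≤s l) = lookup-unitExps-above i k l

  Supported-X : ∀ {N} j → suc j ≤ N → Supported N (X (suc j))
  Supported-X zero    le = Supported-X₁^ (+ 1)
  Supported-X (suc i) le = (λ k l → lookup-unitExps-above i k (ℕP.≤-pred (ℕP.≤-trans le l))) ∷ []

  Supported-ΣP : ∀ {N} m f → (∀ j → 1 ≤ j → j ≤ m → Supported N (f j)) → Supported N (ΣP m f)
  Supported-ΣP zero    f h = []
  Supported-ΣP (suc m) f h =
    AllP.++⁺ (Supported-ΣP m f (λ j a b → h j a (ℕP.m≤n⇒m≤1+n b))) (h (suc m) (s≤s z≤n) ℕP.≤-refl)

  ∂-beyond-support : ∀ N i p → Supported N p → N ≤ suc i → ∂ (suc (suc i)) p ≋ 0P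
  ∂-beyond-support N i p s le = mk≋ λ m → trans (coeff-∂ (suc i) p m) (kernel-zero m p s)
    where
    kernel-zero : ∀ m p → Supported N p →
      linExt (λ m' → expOf (suc i) m' ℤ.* δ m (lowered (suc i) m')) p ≡ + 0
    kernel-zero m []                  []      = refl
    kernel-zero m ((c , (e , r)) ∷ p) (f ∷ s) rewrite f i le | ℤP.*-zeroˡ (δ m (e , decE r i)) | ℤP.*-zeroʳ c =
      trans (ℤP.+-identityˡ _) (kernel-zero m p s)

  Dterm-beyond-support : ∀ N i p → Supported N p → 1 ≤ N → N ≤ i → Dterm i p ≋ 0P
  Dterm-beyond-support N zero    p s pos l with () ← ℕP.≤-trans pos l
  Dterm-beyond-support N (suc i) p s pos l =
    ≋-trans (*-cong (≋-refl {X (suc (suc (suc i)))}) (∂-beyond-support N i p s l)) (*-zeroʳ (X (suc (suc (suc i)))))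

  D-extend : ∀ N p → Supported N p → 1 ≤ N → ∀ M → N ≤ M → D N p ≋ D M p
  D-extend N p s pos zero    le with () ← ℕP.≤-trans pos le
  D-extend N p s pos (suc M) le with ℕP.m≤n⇒m<n∨m≡n le
  ... | inj₂ refl    = ≋-refl
  ... | inj₁ (s≤s l) = ≋-trans (D-extend N p s pos M l)
    (≋-sym (≋-trans (+-cong (≋-refl {D M p}) (Dterm-beyond-support N M p s pos l)) (+-idʳ (D M p))))


-- Writing X₁⁻¹ for X₁^{-1} and e n = -(2n-1) for the X₁-exponent
-- of A_{n,·}, the defining recursion of S turns into
--   A_{n+1,k+1} = X₁⁻¹ (A_{n,k} + D A_{n,k+1})                  (A-rec)
-- for any truncation level N of D that is large enough; the factor X₁^{-2}
-- coming from e (n+1) = e n - 2 is what makes the term -(2n-1) X₂ S_{n,k+1}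
-- combine with X₁ D S_{n,k+1} into X₁⁻¹ D(X₁^{e n} S_{n,k+1}).
-- Part (i) then follows by induction on n: apply A-rec, the induction
-- hypothesis, the Leibniz rule for D, A-rec again on each factor, and
-- Pascal's rule to reassemble the binomial sum.
module PartI where

  open import Defs
  open Ring
  open Derivation
  open Support
  open import Data.Bool using (true; false; T)
  open import Data.Nat as ℕ using (ℕ; zero; suc; _+_; _∸_; _≤_; _<_; z≤n; s≤s)
  import Data.Nat.Properties as ℕP
  open import Data.Nat.Combinatorics using (_C_; nCk+nC[k+1]≡[n+1]C[k+1]; k>n⇒nCk≡0; nCn≡1)
  open import Data.Integer as ℤ using (ℤ; +_; -_)
  import Data.Integer.Properties as ℤP
  import Data.Integer.Solver as ℤ-Solver
  open import Data.List using ([]; _∷_)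
  open import Data.List.Relation.Unary.All using ([])
  import Data.List.Relation.Unary.All.Properties as AllP
  open import Data.Product using (_,_)
  open import Data.Empty using (⊥-elim)
  open import Relation.Binary.PropositionalEquality
  open import Relation.Nullary using (yes; no)
  import Relation.Binary.Reasoning.Setoid as SetoidReasoning

  S-vanish : ∀ n k → n < k → S n k ≡ []
  S-vanish zero    (suc k)  lt       = refl
  S-vanish (suc n) (suc k') (s≤s lt) with suc k' ℕ.≤ᵇ suc n in eq
  ... | false = refl
  ... | true  = ⊥-elim (ℕP.<⇒≱ lt (ℕP.≤-pred (ℕP.≤ᵇ⇒≤ (suc k') (suc n) (subst T (sym eq) _))))

  e : ℕ → ℤ
  e n = - ((+ 2 ℤ.* + n) ℤ.- + 1)

  S-step : ℕ → ℕ → Poly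
  S-step n k' = (e n ·P (X 2 *P S n (suc k')))
    +P (X 1 *P (S n k' +P ΣP (n ∸ k') (λ j → X (suc j) *P ∂ j (S n (suc k')))))

  S-unfold : ∀ n k' → k' ≤ n → S (suc n) (suc k') ≡ S-step n k'
  S-unfold n k' le with suc k' ℕ.≤ᵇ suc n in eq
  ... | true  = refl
  ... | false = ⊥-elim (subst T eq (ℕP.≤⇒≤ᵇ (s≤s le)))

  S-supported : ∀ n k → Supported (suc n ∸ k) (S n k)
  S-supported zero    zero     = Supported-X₁^ _
  S-supported zero    (suc k)  = []
  S-supported (suc n) zero     = []
  S-supported (suc n) (suc k') with k' ℕP.≤? n
  ... | no k'≰n = subst (Supported _) (sym (S-vanish (suc n) (suc k') (s≤s (ℕP.≰⇒> k'≰n)))) []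
  ... | yes k'≤n = subst (Supported (suc n ∸ k')) (sym (S-unfold n k' k'≤n))
                     (subst (λ N → Supported N (S-step n k')) (sym (ℕP.+-∸-assoc 1 k'≤n)) step)
    where
    S₁ = S n (suc k')
    S₁-supported : Supported (suc (n ∸ k')) S₁
    S₁-supported = Supported-mono S₁ (ℕP.n≤1+n _) (S-supported n (suc k'))
    X₂S₁-supported : Supported (suc (n ∸ k')) (X 2 *P S₁)
    X₂S₁-supported with n ∸ k' in eqd
    ... | zero rewrite S-vanish n (suc k') (s≤s (ℕP.m∸n≡0⇒m≤n eqd)) = []
    ... | suc d = Supported-* (X 2) S₁ (Supported-X 1 (s≤s (s≤s z≤n))) (subst (λ N → Supported (suc N) S₁) eqd S₁-supported)
    S₀-supported : Supported (suc (n ∸ k')) (S n k')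
    S₀-supported = subst (λ N → Supported N (S n k')) (ℕP.+-∸-assoc 1 k'≤n) (S-supported n k')
    step : Supported (suc (n ∸ k')) (S-step n k')
    step = AllP.++⁺ (Supported-· (e n) _ X₂S₁-supported)
      (Supported-* (X 1) _ (Supported-X 0 (s≤s z≤n))
        (AllP.++⁺ S₀-supported
          (Supported-ΣP (n ∸ k') _ (λ j _ j≤ → Supported-* (X (suc j)) _ (Supported-X j (s≤s j≤))
                                                  (Supported-∂ j _ S₁-supported)))))

  D-truncation : ∀ n k' N → 1 ≤ N → n ∸ k' ≤ N → D (n ∸ k') (S n (suc k')) ≋ D N (S n (suc k'))
  D-truncation n k' N pos le with n ∸ k' in eqd
  ... | zero rewrite S-vanish n (suc k') (s≤s (ℕP.m∸n≡0⇒m≤n eqd)) = ≋-sym (D-0 N)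
  ... | suc d = D-extend (suc d) (S n (suc k'))
                  (subst (λ N → Supported N (S n (suc k'))) eqd (S-supported n (suc k'))) (s≤s z≤n) N le

  X₁⁻¹ : Poly
  X₁⁻¹ = X₁^ (- + 1)

  X₁^-cong : ∀ {a b} → a ≡ b → X₁^ a ≋ X₁^ b
  X₁^-cong refl = ≋-refl

  X₁^-pred : ∀ a → X₁^ (a ℤ.- + 1) ≋ X₁⁻¹ *P X₁^ a
  X₁^-pred a = X₁^-cong (ℤP.+-comm a (- + 1))

  X₁^e-suc : ∀ n → X₁^ (e (suc n)) ≋ X₁⁻¹ *P (X₁⁻¹ *P X₁^ (e n))
  X₁^e-suc n = X₁^-cong
    (solve 1 (λ x → :- ((con (+ 2) :* (con (+ 1) :+ x)) :- con (+ 1))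
                  := (:- con (+ 1)) :+ ((:- con (+ 1)) :+ (:- ((con (+ 2) :* x) :- con (+ 1))))) refl (+ n))
    where open ℤ-Solver.+-*-Solver

  D-X₁^ : ∀ N a → 1 ≤ N → D N (X₁^ a) ≋ scalar a *P (X 2 *P (X₁⁻¹ *P X₁^ a))
  D-X₁^ (suc N) a _ = begin
      D (suc N) (X₁^ a)
    ≈⟨ Σ<-shift N (λ i → Dterm i (X₁^ a)) ⟩
      Dterm 0 (X₁^ a) +P Σ< N (λ i → Dterm (suc i) (X₁^ a))
    ≈⟨ +-cong ≋-refl (Σ<-0 N _ (λ i _ → Dterm-beyond-support 1 (suc i) (X₁^ a) (Supported-X₁^ a) (s≤s z≤n) (s≤s z≤n))) ⟩
      Dterm 0 (X₁^ a) +P 0P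
    ≈⟨ +-idʳ _ ⟩
      X 2 *P ((+ 1 ℤ.* a , (a ℤ.- + 1 , [])) ∷ [])
    ≈⟨ *-cong (≋-refl {X 2}) (≡⇒≋ (cong (λ c → (c , (a ℤ.- + 1 , [])) ∷ [])
                                         (trans (ℤP.*-identityˡ a) (sym (ℤP.*-identityʳ a))))) ⟩
      X 2 *P (a ·P X₁^ (a ℤ.- + 1))
    ≈⟨ *-cong (≋-refl {X 2}) (·-scalar a (X₁^ (a ℤ.- + 1))) ⟩
      X 2 *P (scalar a *P X₁^ (a ℤ.- + 1))
    ≈⟨ *-cong (≋-refl {X 2}) (*-cong (≋-refl {scalar a}) (X₁^-pred a)) ⟩
      X 2 *P (scalar a *P (X₁⁻¹ *P X₁^ a))
    ≈⟨ solve 3 (λ x k y → x :* (k :* y) := k :* (x :* y)) ≋-refl (X 2) (scalar a) (X₁⁻¹ *P X₁^ a) ⟩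
      scalar a *P (X 2 *P (X₁⁻¹ *P X₁^ a)) ∎
    where
    open SetoidReasoning PolySetoid
    open R-Solver

  A-rec-algebra : ∀ N a S₀ S₁ → 1 ≤ N →
    (X₁⁻¹ *P (X₁⁻¹ *P X₁^ a)) *P ((a ·P (X 2 *P S₁)) +P (X 1 *P (S₀ +P D N S₁)))
    ≋ X₁⁻¹ *P (X₁^ a *P S₀ +P D N (X₁^ a *P S₁))
  A-rec-algebra N a S₀ S₁ pos = begin
      (U *P (U *P E)) *P ((a ·P (X 2 *P S₁)) +P (X 1 *P (S₀ +P DS₁)))
    ≈⟨ *-cong (≋-refl {U *P (U *P E)}) (+-cong (·-scalar a (X 2 *P S₁)) ≋-refl) ⟩
      (U *P (U *P E)) *P ((Ka *P (X 2 *P S₁)) +P (X 1 *P (S₀ +P DS₁)))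
    ≈⟨ solve 8 (λ U E Ka X₂ X₁ S₀ S₁ DS₁ → (U :* (U :* E)) :* ((Ka :* (X₂ :* S₁)) :+ (X₁ :* (S₀ :+ DS₁)))
                  := U :* (Ka :* (X₂ :* (U :* E)) :* S₁) :+ (U :* E :* (S₀ :+ DS₁)) :* (U :* X₁))
         ≋-refl U E Ka (X 2) (X 1) S₀ S₁ DS₁ ⟩
      U *P (Ka *P (X 2 *P (U *P E)) *P S₁) +P (U *P E *P (S₀ +P DS₁)) *P (U *P X 1)
    ≈⟨ +-cong ≋-refl (≋-trans (*-cong (≋-refl {U *P E *P (S₀ +P DS₁)}) (≋-refl {1P})) (*-idʳ _)) ⟩
      U *P (Ka *P (X 2 *P (U *P E)) *P S₁) +P U *P E *P (S₀ +P DS₁)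
    ≈⟨ solve 6 (λ U E K S₀ S₁ DS₁ → U :* (K :* S₁) :+ U :* E :* (S₀ :+ DS₁)
                  := U :* (E :* S₀ :+ (K :* S₁ :+ E :* DS₁)))
         ≋-refl U E (Ka *P (X 2 *P (U *P E))) S₀ S₁ DS₁ ⟩
      U *P (E *P S₀ +P (Ka *P (X 2 *P (U *P E)) *P S₁ +P E *P DS₁))
    ≈⟨ *-cong (≋-refl {U}) (+-cong ≋-refl (≋-sym (≋-trans (D-* N E S₁) (+-cong (*-cong (D-X₁^ N a pos) ≋-refl) ≋-refl)))) ⟩
      U *P (E *P S₀ +P D N (E *P S₁)) ∎
    where
    open SetoidReasoning PolySetoid
    open R-Solver
    U = X₁⁻¹
    E = X₁^ a
    Ka = scalar a
    DS₁ = D N S₁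

  A-vanish : ∀ n k → n < k → A n k ≋ 0P
  A-vanish n k lt = ≋-trans (≡⇒≋ (cong (X₁^ (e n) *P_) (S-vanish n k lt))) (*-zeroʳ (X₁^ (e n)))

  A-column0 : ∀ n → 0 < n → A n 0 ≋ 0P
  A-column0 (suc m) _ = *-zeroʳ (X₁^ (e (suc m)))

  A-rec : ∀ n k' N → 1 ≤ N → n ∸ k' ≤ N → A (suc n) (suc k') ≋ X₁⁻¹ *P (A n k' +P D N (A n (suc k')))
  A-rec n k' N pos le with k' ℕP.≤? n
  ... | yes k'≤n = begin
      X₁^ (e (suc n)) *P S (suc n) (suc k')
    ≈⟨ *-cong (X₁^e-suc n) (≡⇒≋ (S-unfold n k' k'≤n)) ⟩
      (X₁⁻¹ *P (X₁⁻¹ *P X₁^ (e n))) *P S-step n k'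
    ≈⟨ *-cong (≋-refl {X₁⁻¹ *P (X₁⁻¹ *P X₁^ (e n))})
         (+-cong (≋-refl {e n ·P (X 2 *P S n (suc k'))}) (*-cong (≋-refl {X 1}) (+-cong (≋-refl {S n k'})
           (≋-trans (≡⇒≋ (ΣP≡D (n ∸ k') (S n (suc k')))) (D-truncation n k' N pos le))))) ⟩
      (X₁⁻¹ *P (X₁⁻¹ *P X₁^ (e n))) *P ((e n ·P (X 2 *P S n (suc k'))) +P (X 1 *P (S n k' +P D N (S n (suc k')))))
    ≈⟨ A-rec-algebra N (e n) (S n k') (S n (suc k')) pos ⟩
      X₁⁻¹ *P (A n k' +P D N (A n (suc k'))) ∎
    where open SetoidReasoning PolySetoid
  ... | no k'≰n = begin
      A (suc n) (suc k')
    ≈⟨ A-vanish (suc n) (suc k') (s≤s n<k') ⟩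
      0P
    ≈⟨ ≋-sym (≋-trans (*-cong (≋-refl {X₁⁻¹}) (+-cong (A-vanish n k' n<k')
                        (≋-trans (D-cong N (A-vanish n (suc k') (ℕP.m≤n⇒m≤1+n n<k'))) (D-0 N))))
                       (*-zeroʳ X₁⁻¹)) ⟩
      X₁⁻¹ *P (A n k' +P D N (A n (suc k'))) ∎
    where
    open SetoidReasoning PolySetoid
    n<k' = ℕP.≰⇒> k'≰n

  A-column1-rec : ∀ i N → suc i ≤ N → A (suc (suc i)) 1 ≋ X₁⁻¹ *P D N (A (suc i) 1)
  A-column1-rec i N le = ≋-trans (A-rec (suc i) 0 N (ℕP.≤-trans (s≤s z≤n) le) le)
    (*-cong (≋-refl {X₁⁻¹}) (≋-trans (+-cong (A-column0 (suc i) (s≤s z≤n)) ≋-refl) (+-idˡ _)))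

  D-product-step : ∀ N c a a' B B' B₀ → X₁⁻¹ *P D N a ≋ a' → B' ≋ X₁⁻¹ *P (B₀ +P D N B) →
    X₁⁻¹ *P D N (c ·P (a *P B)) ≋ (c ·P (a' *P B) +P c ·P (a *P B')) +P (-P (X₁⁻¹ *P (c ·P (a *P B₀))))
  D-product-step N c a a' B B' B₀ a'≋ B'≋ = begin
      U *P D N (c ·P (a *P B))
    ≈⟨ *-cong (≋-refl {U}) (≋-trans (D-· N c (a *P B)) (≋-trans (·-scalar c _) (*-cong (≋-refl {Kc}) (D-* N a B)))) ⟩
      U *P (Kc *P (D N a *P B +P a *P D N B))
    ≈⟨ solve 7 (λ U K Da B a DB B₀ → U :* (K :* (Da :* B :+ a :* DB))
                  := (K :* ((U :* Da) :* B) :+ K :* (a :* (U :* (B₀ :+ DB)))) :+ (:- (U :* (K :* (a :* B₀)))))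
         ≋-refl U Kc (D N a) B a (D N B) B₀ ⟩
      (Kc *P ((U *P D N a) *P B) +P Kc *P (a *P (U *P (B₀ +P D N B)))) +P (-P (U *P (Kc *P (a *P B₀))))
    ≈⟨ +-cong (+-cong (*-cong (≋-refl {Kc}) (*-cong a'≋ (≋-refl {B})))
                      (*-cong (≋-refl {Kc}) (*-cong (≋-refl {a}) (≋-sym B'≋)))) ≋-refl ⟩
      (Kc *P (a' *P B) +P Kc *P (a *P B')) +P (-P (U *P (Kc *P (a *P B₀))))
    ≈⟨ ≋-sym (+-cong (+-cong (·-scalar c (a' *P B)) (·-scalar c (a *P B'))) (-‿cong (*-cong (≋-refl {U}) (·-scalar c (a *P B₀))))) ⟩
      (c ·P (a' *P B) +P c ·P (a *P B')) +P (-P (U *P (c ·P (a *P B₀)))) ∎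
    where
    open SetoidReasoning PolySetoid
    open R-Solver
    U = X₁⁻¹
    Kc = scalar c

  pascal : ∀ n (G : ℕ → Poly) → G (suc n) ≋ 0P →
    Σ< n (λ i → (+ ((n ∸ 1) C i)) ·P G (suc (suc i))) +P Σ< n (λ i → (+ ((n ∸ 1) C i)) ·P G (suc i))
    ≋ Σ< (suc n) (λ i → (+ (n C i)) ·P G (suc i))
  pascal zero     G G₁≋0 = ≋-sym (≋-trans (+-cong (≋-refl {0P}) (≋-trans (·-1 (G 1)) G₁≋0)) (+-idˡ 0P))
  pascal (suc n') G Gₙ≋0 = begin
      L +P Σ< (suc n') (λ i → (+ (n' C i)) ·P G (suc i))
    ≈⟨ +-cong (≋-refl {L}) (Σ<-shift n' _) ⟩
      L +P (G₁ +P Σ< n' (λ i → (+ (n' C suc i)) ·P G (suc (suc i))))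
    ≈⟨ +-cong (≋-refl {L}) (+-cong (≋-refl {G₁}) (≋-sym (≋-trans (+-cong ≋-refl last≋0) (+-idʳ _)))) ⟩
      L +P (G₁ +P L')
    ≈⟨ solve 3 (λ a b c → a :+ (b :+ c) := b :+ (a :+ c)) ≋-refl L G₁ L' ⟩
      G₁ +P (L +P L')
    ≈⟨ +-cong (≋-refl {G₁}) (≋-sym (Σ<-+ (suc n') _ _)) ⟩
      G₁ +P Σ< (suc n') (λ i → ((+ (n' C i)) ·P G (suc (suc i))) +P ((+ (n' C suc i)) ·P G (suc (suc i))))
    ≈⟨ +-cong (≋-refl {G₁}) (Σ<-cong (suc n') (λ i _ → ≋-trans (≋-sym (·-+ (+ (n' C i)) (+ (n' C suc i)) _))
                                                  (≡⇒≋ (cong (λ c → + c ·P G (suc (suc i))) (nCk+nC[k+1]≡[n+1]C[k+1] n' i))))) ⟩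
      G₁ +P Σ< (suc n') (λ i → (+ (suc n' C suc i)) ·P G (suc (suc i)))
    ≈⟨ ≋-sym (Σ<-shift (suc n') _) ⟩
      Σ< (suc (suc n')) (λ i → (+ (suc n' C i)) ·P G (suc i)) ∎
    where
    open SetoidReasoning PolySetoid
    open R-Solver
    G₁ = + 1 ·P G 1
    L  = Σ< (suc n') (λ i → (+ (n' C i)) ·P G (suc (suc i)))
    L' = Σ< (suc n') (λ i → (+ (n' C suc i)) ·P G (suc (suc i)))
    last≋0 : (+ (n' C suc n')) ·P G (suc (suc n')) ≋ 0P
    last≋0 = ≋-trans (≡⇒≋ (cong (λ c → + c ·P G (suc (suc n'))) (k>n⇒nCk≡0 (ℕP.n<1+n n')))) (·-0 _)

  -- The i-th summand of the right-hand side of (i), for 0 ≤ i < n (j = i + 1).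
  convTerm : ℕ → ℕ → ℕ → Poly
  convTerm n k i = (+ ((n ∸ 1) C i)) ·P (A (suc i) 1 *P A (n ∸ suc i) (k ∸ 1))

  conv : ℕ → ℕ → Poly
  conv n k = Σ< n (convTerm n k)

  convTerm-vanish : ∀ n k i → A (n ∸ suc i) (k ∸ 1) ≋ 0P → convTerm n k i ≋ 0P
  convTerm-vanish n k i A≋0 =
    ≋-trans (·-cong c (≋-trans (*-cong (≋-refl {A (suc i) 1}) A≋0) (*-zeroʳ (A (suc i) 1))))
            (≋-trans (·-scalar c 0P) (*-zeroʳ (scalar c)))
    where c = + ((n ∸ 1) C i)

  Σ<-combine : ∀ n p q r → Σ< n (λ i → (p i +P q i) +P (-P (X₁⁻¹ *P r i)))
                          ≋ (Σ< n p +P Σ< n q) +P (-P (X₁⁻¹ *P Σ< n r))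
  Σ<-combine n p q r = ≋-trans (Σ<-+ n _ _) (+-cong (Σ<-+ n p q)
    (≋-sym (≋-trans (-‿cong (Σ<-*l n X₁⁻¹ r)) (Σ<-· n (- + 1) _))))

  -- Part (i) with the sum extended to all j ≤ n.
  partI-conv : ∀ n k' → A n (suc k') ≋ conv n (suc k')
  partI-conv zero    k'  = A-vanish 0 (suc k') (s≤s z≤n)
  partI-conv (suc n) zero = ≋-sym (≋-trans (+-cong (Σ<-0 n _ earlier≋0) last≋) (+-idˡ (A (suc n) 1)))
    where
    earlier≋0 : ∀ i → i < n → convTerm (suc n) 1 i ≋ 0P
    earlier≋0 i lt = convTerm-vanish (suc n) 1 i (A-column0 (n ∸ i) (ℕP.m<n⇒0<n∸m lt))
    last≋ : convTerm (suc n) 1 n ≋ A (suc n) 1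
    last≋ = ≋-trans (≡⇒≋ (cong₂ (λ c d → (+ c) ·P (A (suc n) 1 *P A d 0)) (nCn≡1 n) (ℕP.n∸n≡0 n)))
                    (≋-trans (·-1 _) (*-idʳ (A (suc n) 1)))
  partI-conv (suc n) (suc k'') = begin
      A (suc n) k₂
    ≈⟨ A-rec n k₁ N (s≤s z≤n) (ℕP.≤-trans (ℕP.m∸n≤m n k₁) (ℕP.n≤1+n n)) ⟩
      U *P (A n k₁ +P D N (A n k₂))
    ≈⟨ *-cong (≋-refl {U}) (+-cong (partI-conv n k'') (D-cong N (partI-conv n k₁))) ⟩
      U *P (conv n k₁ +P D N (conv n k₂))
    ≈⟨ *-cong (≋-refl {U}) (+-cong (≋-refl {conv n k₁}) (D-Σ< N n (convTerm n k₂))) ⟩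
      U *P (conv n k₁ +P Σ< n (λ i → D N (convTerm n k₂ i)))
    ≈⟨ ≋-trans (distribˡ U (conv n k₁) _) (+-cong (≋-refl {U *P conv n k₁}) (Σ<-*l n U _)) ⟩
      U *P conv n k₁ +P Σ< n (λ i → U *P D N (convTerm n k₂ i))
    ≈⟨ +-cong (≋-refl {U *P conv n k₁}) (≋-trans (Σ<-cong n step) (Σ<-combine n P Q (convTerm n k₁))) ⟩
      U *P conv n k₁ +P ((Σ< n P +P Σ< n Q) +P (-P (U *P conv n k₁)))
    ≈⟨ solve 3 (λ x y z → x :+ ((y :+ z) :+ (:- x)) := y :+ z) ≋-refl (U *P conv n k₁) (Σ< n P) (Σ< n Q) ⟩
      Σ< n P +P Σ< n Q
    ≈⟨ +-cong (≋-refl {Σ< n P}) (Σ<-cong n Q≡) ⟩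
      Σ< n (λ i → (+ ((n ∸ 1) C i)) ·P G (suc (suc i))) +P Σ< n (λ i → (+ ((n ∸ 1) C i)) ·P G (suc i))
    ≈⟨ pascal n G Gₙ₊₁≋0 ⟩
      conv (suc n) k₂ ∎
    where
    open SetoidReasoning PolySetoid
    open R-Solver
    U = X₁⁻¹
    k₁ = suc k''
    k₂ = suc k₁
    N = suc n
    G : ℕ → Poly
    G j = A j 1 *P A (suc n ∸ j) k₁
    Gₙ₊₁≋0 : G (suc n) ≋ 0P
    Gₙ₊₁≋0 = ≋-trans (≡⇒≋ (cong (λ d → A (suc n) 1 *P A d k₁) (ℕP.n∸n≡0 n)))
               (≋-trans (*-cong (≋-refl {A (suc n) 1}) (A-vanish 0 k₁ (s≤s z≤n))) (*-zeroʳ (A (suc n) 1)))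
    P Q : ℕ → Poly
    P i = (+ ((n ∸ 1) C i)) ·P (A (suc (suc i)) 1 *P A (n ∸ suc i) k₁)
    Q i = (+ ((n ∸ 1) C i)) ·P (A (suc i) 1 *P A (suc (n ∸ suc i)) k₁)
    Q≡ : ∀ i → i < n → Q i ≋ (+ ((n ∸ 1) C i)) ·P G (suc i)
    Q≡ i lt = ≡⇒≋ (cong (λ d → (+ ((n ∸ 1) C i)) ·P (A (suc i) 1 *P A d k₁)) (sym (ℕP.+-∸-assoc 1 lt)))
    step : ∀ i → i < n → U *P D N (convTerm n k₂ i) ≋ (P i +P Q i) +P (-P (U *P convTerm n k₁ i))
    step i lt = D-product-step N (+ ((n ∸ 1) C i)) (A (suc i) 1) (A (suc (suc i)) 1)
      (A m k₁) (A (suc m) k₁) (A m k'')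
      (≋-sym (A-column1-rec i N (s≤s (ℕP.<⇒≤ lt))))
      (A-rec m k'' N (s≤s z≤n) (ℕP.≤-trans (ℕP.m∸n≤m m k'') (ℕP.≤-trans (ℕP.m∸n≤m n (suc i)) (ℕP.n≤1+n n))))
      where m = n ∸ suc i

  -- Indices beyond n - k contribute A_{n-1-i,k-1} with n - 1 - i < k - 1.
  tail-index : ∀ n k i → n ∸ k ≤ i → i < n → n ∸ suc i < k
  tail-index n k i n∸k≤i i<n = subst (_≤ k) (ℕP.+-∸-assoc 1 i<n)
    (ℕP.m≤n+o⇒m∸n≤o n i (ℕP.≤-trans (ℕP.m≤n+m∸n n k)
      (ℕP.≤-trans (ℕP.+-monoʳ-≤ k n∸k≤i) (ℕP.≤-reflexive (ℕP.+-comm k i)))))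

  -- Part (i); the summands with n-k+1 < j ≤ n that conv adds vanish.
  partI : ∀ n k → 1 ≤ k → k ≤ n →
    A n k ≈ ΣP (n ∸ k + 1) (λ j → (+ ((n ∸ 1) C (j ∸ 1))) ·P (A j 1 *P A (n ∸ j) (k ∸ 1)))
  partI n (suc k') _ k≤n = get≋ (≋-trans (partI-conv n k')
    (≋-sym (≋-trans (≡⇒≋ (ΣP≡Σ< R _)) (Σ<-extend R (convTerm n (suc k')) n R≤n tail≋0))))
    where
    R = n ∸ suc k' + 1
    R≡ : R ≡ n ∸ k'
    R≡ = trans (ℕP.+-comm (n ∸ suc k') 1) (sym (ℕP.+-∸-assoc 1 k≤n))
    R≤n : R ≤ n
    R≤n = subst (_≤ n) (sym R≡) (ℕP.m∸n≤m n k')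
    tail≋0 : ∀ i → R ≤ i → i < n → convTerm n (suc k') i ≋ 0P
    tail≋0 i R≤i i<n = convTerm-vanish n (suc k') i
      (A-vanish (n ∸ suc i) k' (tail-index n k' i (subst (_≤ i) R≡ R≤i) i<n))


-- A monomial X₁^{r₀} X₂^{r₁} ⋯ is a
-- list t = (r₀, r₁, …): rₚ blocks of size p+1.  Its coefficient in B_{n,k}
-- is n! / ∏ rₚ! ((p+1)!)^{rₚ} when t has k blocks of total size n
-- (isType), and 0 otherwise.  Removing one block of size p+1 from t gives
-- decE t p; the identity
--   n!/den t = Σ_p C(n-1,p) [rₚ ≥ 1] (n-1-p)!/den (decE t p)      (bell-recurrence)
-- is obtained after multiplying by den t = den (decE t p) · rₚ · (p+1)!, where
-- it becomes n! = (n-1)! Σ_p (p+1) rₚ.  The same sum shows that the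
-- division defining bellCoeff is exact (den∣!).
module BellNumbers where

  open import Defs
  open Monomials using (≡ᵇ-sound; ≡ᵇ-refl)
  open import Data.Bool using (Bool; true; false; _∧_; if_then_else_)
  open import Data.Bool.Properties using (∧-conicalˡ; ∧-conicalʳ)
  open import Data.Nat as ℕ using (ℕ; zero; suc; _∸_; _+_; _*_; _≤_; _<_; _!; _^_; z≤n; s≤s)
  import Data.Nat.Properties as ℕP
  open import Data.Nat.Solver using (module +-*-Solver)
  open import Data.Nat.Divisibility using (_∣_; ∣m∣n⇒∣m+n; _∣0; ∣-trans; n∣m*n; *-pres-∣; ∣-refl; ∣-reflexive; 1∣_)
  open import Data.Nat.Combinatorics using (_C_; nCk≡n!/k![n-k]!; k![n∸k]!∣n!)
  open import Data.Nat.DivMod using (_/_; m/n*n≡m)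
  open import Data.List using (List; []; _∷_)
  open import Data.Sum using (_⊎_; inj₁; inj₂)
  open import Data.Empty using (⊥-elim)
  open import Relation.Binary.PropositionalEquality

  _≐_ : List ℕ → List ℕ → Set
  r ≐ s = ∀ i → lookupE r i ≡ lookupE s i

  AllZero : List ℕ → Set
  AllZero t = ∀ p → lookupE t p ≡ 0

  AllZero-sumL : ∀ t → AllZero t → sumL t ≡ 0
  AllZero-sumL [] h = refl
  AllZero-sumL (x ∷ xs) h = cong₂ _+_ (h 0) (AllZero-sumL xs (λ p → h (suc p)))

  AllZero-wsum : ∀ i t → AllZero t → wsum i t ≡ 0
  AllZero-wsum i [] h = refl
  AllZero-wsum i (x ∷ xs) h rewrite h 0 | AllZero-wsum (suc i) xs (λ p → h (suc p)) = trans (ℕP.+-identityʳ (i * 0)) (ℕP.*-zeroʳ i)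

  sumL0-den : ∀ i t → sumL t ≡ 0 → den i t ≡ 1
  sumL0-den i [] _ = refl
  sumL0-den i (zero ∷ xs) h = trans (ℕP.+-identityʳ _) (sumL0-den (suc i) xs h)

  AllZero-den : ∀ i t → AllZero t → den i t ≡ 1
  AllZero-den i t h = sumL0-den i t (AllZero-sumL t h)

  sumL-≐ : ∀ r s → r ≐ s → sumL r ≡ sumL s
  sumL-≐ [] [] h = refl
  sumL-≐ [] (y ∷ ys) h = sym (AllZero-sumL (y ∷ ys) (λ p → sym (h p)))
  sumL-≐ (x ∷ xs) [] h = AllZero-sumL (x ∷ xs) h
  sumL-≐ (x ∷ xs) (y ∷ ys) h = cong₂ _+_ (h 0) (sumL-≐ xs ys (λ i → h (suc i)))

  wsum-≐ : ∀ i r s → r ≐ s → wsum i r ≡ wsum i s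
  wsum-≐ i [] [] h = refl
  wsum-≐ i [] (y ∷ ys) h = sym (AllZero-wsum i (y ∷ ys) (λ p → sym (h p)))
  wsum-≐ i (x ∷ xs) [] h = AllZero-wsum i (x ∷ xs) h
  wsum-≐ i (x ∷ xs) (y ∷ ys) h = cong₂ _+_ (cong (i *_) (h 0)) (wsum-≐ (suc i) xs ys (λ i → h (suc i)))

  den-≐ : ∀ i r s → r ≐ s → den i r ≡ den i s
  den-≐ i [] [] h = refl
  den-≐ i [] (y ∷ ys) h = sym (AllZero-den i (y ∷ ys) (λ p → sym (h p)))
  den-≐ i (x ∷ xs) [] h = AllZero-den i (x ∷ xs) h
  den-≐ i (x ∷ xs) (y ∷ ys) h = cong₂ _*_ (cong (λ z → z ! * (i !) ^ z) (h 0)) (den-≐ (suc i) xs ys (λ i → h (suc i)))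

  lookup-pos-or-0 : ∀ t p → 1 ≤ lookupE t p ⊎ lookupE t p ≡ 0
  lookup-pos-or-0 t p with lookupE t p
  ... | zero  = inj₂ refl
  ... | suc _ = inj₁ (s≤s z≤n)

  sumL-decE : ∀ t p → 1 ≤ lookupE t p → sumL t ≡ suc (sumL (decE t p))
  sumL-decE (suc x ∷ xs) zero _ = refl
  sumL-decE (x ∷ xs) (suc p) h = trans (cong (x +_) (sumL-decE xs p h)) (ℕP.+-suc x _)

  wsum-decE : ∀ i t p → 1 ≤ lookupE t p → wsum i t ≡ wsum i (decE t p) + (i + p)
  wsum-decE i (suc x ∷ xs) zero _ =
    solve 3 (λ i x w → i :* (con 1 :+ x) :+ w := i :* x :+ w :+ (i :+ con 0)) refl i x (wsum (suc i) xs)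
    where open +-*-Solver
  wsum-decE i (x ∷ xs) (suc p) h rewrite wsum-decE (suc i) xs p h | ℕP.+-suc i p = sym (ℕP.+-assoc (i * x) _ _)

  den-decE : ∀ i t p → 1 ≤ lookupE t p → den i t ≡ den i (decE t p) * (lookupE t p * (i + p) !)
  den-decE i (suc x ∷ xs) zero _ rewrite ℕP.+-identityʳ i =
    solve 5 (λ x xf f P d → ((con 1 :+ x) :* xf :* (f :* P)) :* d := (xf :* P) :* d :* ((con 1 :+ x) :* f))
      refl x (x !) (i !) ((i !) ^ x) (den (suc i) xs)
    where open +-*-Solver
  den-decE i (x ∷ xs) (suc p) h rewrite den-decE (suc i) xs p h | ℕP.+-suc i p = sym (ℕP.*-assoc (x ! * (i !) ^ x) _ _)

  wsum-removeBlock : ∀ t n p → wsum 1 t ≡ n → 1 ≤ lookupE t p → wsum 1 (decE t p) ≡ n ∸ suc p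
  wsum-removeBlock t n p hw hl = sym (trans (cong (_∸ suc p) (trans (sym hw) (wsum-decE 1 t p hl))) (ℕP.m+n∸n≡m _ (suc p)))

  sumL≤wsum : ∀ i t → 1 ≤ i → sumL t ≤ wsum i t
  sumL≤wsum i [] _ = z≤n
  sumL≤wsum i (x ∷ xs) h = ℕP.+-mono-≤ (ℕP.≤-trans (ℕP.≤-reflexive (sym (ℕP.*-identityˡ x))) (ℕP.*-monoˡ-≤ x h))
                                       (sumL≤wsum (suc i) xs (ℕP.m≤n⇒m≤1+n h))

  sumL0-lookup : ∀ t → sumL t ≡ 0 → ∀ p → lookupE t p ≡ 0
  sumL0-lookup [] h p = refl
  sumL0-lookup (zero ∷ xs) h zero = refl
  sumL0-lookup (zero ∷ xs) h (suc p) = sumL0-lookup xs h p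

  lookup≤sumL : ∀ t p → lookupE t p ≤ sumL t
  lookup≤sumL [] p = z≤n
  lookup≤sumL (x ∷ xs) zero = ℕP.m≤m+n x _
  lookup≤sumL (x ∷ xs) (suc p) = ℕP.≤-trans (lookup≤sumL xs p) (ℕP.m≤n+m _ x)

  block-bound : ∀ t n k p → sumL t ≡ k → wsum 1 t ≡ n → 1 ≤ lookupE t p → p + k ≤ n
  block-bound t n k p hs hw hl = begin
      p + k
    ≡⟨ cong (p +_) (trans (sym hs) (sumL-decE t p hl)) ⟩
      p + suc (sumL (decE t p))
    ≤⟨ ℕP.+-monoʳ-≤ p (s≤s (sumL≤wsum 1 (decE t p) ℕP.≤-refl)) ⟩
      p + suc (wsum 1 (decE t p))
    ≡⟨ solve 2 (λ p w → p :+ (con 1 :+ w) := w :+ (con 1 :+ p)) refl p (wsum 1 (decE t p)) ⟩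
      wsum 1 (decE t p) + (1 + p)
    ≡⟨ sym (trans (sym hw) (wsum-decE 1 t p hl)) ⟩
      n ∎
    where open ℕP.≤-Reasoning
          open +-*-Solver

  lookup-beyond-weight : ∀ t n p → wsum 1 t ≡ n → n ≤ p → lookupE t p ≡ 0
  lookup-beyond-weight t n p hw n≤p with lookup-pos-or-0 t p
  ... | inj₂ tₚ≡0 = tₚ≡0
  ... | inj₁ tₚ≥1 = ⊥-elim (ℕP.<⇒≱ p<n n≤p)
    where
    p<n : p < n
    p<n = ℕP.≤-trans (subst (_≤ p + sumL t) (ℕP.+-comm p 1) (ℕP.+-monoʳ-≤ p (ℕP.≤-trans tₚ≥1 (lookup≤sumL t p))))
                     (block-bound t n (sumL t) p refl hw tₚ≥1)

  Σℕ : ℕ → (ℕ → ℕ) → ℕ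
  Σℕ zero f = 0
  Σℕ (suc R) f = Σℕ R f + f R

  Σℕ-shift : ∀ R f → Σℕ (suc R) f ≡ f 0 + Σℕ R (λ p → f (suc p))
  Σℕ-shift zero f = ℕP.+-comm 0 (f 0)
  Σℕ-shift (suc R) f rewrite Σℕ-shift R f = ℕP.+-assoc (f 0) _ _

  Σℕ-cong : ∀ R {f g} → (∀ p → p < R → f p ≡ g p) → Σℕ R f ≡ Σℕ R g
  Σℕ-cong zero h = refl
  Σℕ-cong (suc R) h = cong₂ _+_ (Σℕ-cong R (λ p l → h p (ℕP.m≤n⇒m≤1+n l))) (h R ℕP.≤-refl)

  Σℕ-* : ∀ R c f → Σℕ R (λ p → c * f p) ≡ c * Σℕ R f
  Σℕ-* zero c f = sym (ℕP.*-zeroʳ c)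
  Σℕ-* (suc R) c f rewrite Σℕ-* R c f = sym (ℕP.*-distribˡ-+ c (Σℕ R f) (f R))

  Σℕ-extend : ∀ R f M → R ≤ M → (∀ p → R ≤ p → p < M → f p ≡ 0) → Σℕ R f ≡ Σℕ M f
  Σℕ-extend R f zero le h with z≤n ← le = refl
  Σℕ-extend R f (suc M) le h with ℕP.m≤n⇒m<n∨m≡n le
  ... | inj₂ refl = refl
  ... | inj₁ (s≤s lt) = trans (Σℕ-extend R f M lt (λ p a b → h p a (ℕP.m≤n⇒m≤1+n b)))
                              (sym (trans (cong (Σℕ M f +_) (h M lt ℕP.≤-refl)) (ℕP.+-identityʳ _)))

  Σℕ-∣ : ∀ d R f → (∀ p → p < R → d ∣ f p) → d ∣ Σℕ R f
  Σℕ-∣ d zero f h = d ∣0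
  Σℕ-∣ d (suc R) f h = ∣m∣n⇒∣m+n (Σℕ-∣ d R f (λ p l → h p (ℕP.m≤n⇒m≤1+n l))) (h R ℕP.≤-refl)

  Σℕ-0 : ∀ R f → (∀ p → p < R → f p ≡ 0) → Σℕ R f ≡ 0
  Σℕ-0 zero    f h = refl
  Σℕ-0 (suc R) f h rewrite Σℕ-0 R f (λ p l → h p (ℕP.m≤n⇒m≤1+n l)) | h R ℕP.≤-refl = refl

  wsum-Σℕ : ∀ i t R → (∀ p → R ≤ p → lookupE t p ≡ 0) → Σℕ R (λ p → (i + p) * lookupE t p) ≡ wsum i t
  wsum-Σℕ i [] R h = trans (Σℕ-cong R (λ p _ → ℕP.*-zeroʳ (i + p))) (z R)
    where z : ∀ R → Σℕ R (λ _ → 0) ≡ 0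
          z zero = refl
          z (suc R) = cong (_+ 0) (z R)
  wsum-Σℕ i (x ∷ xs) zero h = sym (trans (cong₂ _+_ (cong (i *_) (h 0 z≤n)) (AllZero-wsum (suc i) xs (λ p → h (suc p) z≤n)))
                                         (trans (ℕP.+-identityʳ (i * 0)) (ℕP.*-zeroʳ i)))
  wsum-Σℕ i (x ∷ xs) (suc R) h = trans (Σℕ-shift R _) (cong₂ _+_ (cong (_* x) (ℕP.+-identityʳ i))
    (trans (Σℕ-cong R (λ p _ → cong (_* lookupE xs p) (ℕP.+-suc i p))) (wsum-Σℕ (suc i) xs R (λ p l → h (suc p) (s≤s l)))))

  -- Distinguishing the block of size p+1 that contains a fixed element:
  -- Σ_p C(n',p) (n'-p)! (p+1)! rₚ = n'! Σ_p (p+1) rₚ = (n'+1)! for a type of n'+1.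
  binomial-factorials : ∀ n p → p ≤ n → (n C p) * (p ! * (n ∸ p) !) ≡ n !
  binomial-factorials n p le = trans (cong (_* (p ! * (n ∸ p) !)) (nCk≡n!/k![n-k]! le)) (m/n*n≡m {{_}} (k![n∸k]!∣n! le))

  blockTerm : ℕ → List ℕ → ℕ → ℕ
  blockTerm n' t p = (n' C p) * ((n' ∸ p) ! * ((suc p) ! * lookupE t p))

  blockTerm-value : ∀ n' t p → p ≤ n' → blockTerm n' t p ≡ n' ! * (suc p * lookupE t p)
  blockTerm-value n' t p le = trans
    (solve 5 (λ c a b q l → c :* (a :* ((con 1 :+ q) :* b :* l)) := (c :* (b :* a)) :* ((con 1 :+ q) :* l))
       refl (n' C p) ((n' ∸ p) !) (p !) p (lookupE t p))
    (cong (_* (suc p * lookupE t p)) (binomial-factorials n' p le))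
    where open +-*-Solver
  blockTerm-0 : ∀ n' t p → lookupE t p ≡ 0 → blockTerm n' t p ≡ 0
  blockTerm-0 n' t p e rewrite e =
    trans (cong ((n' C p) *_) (trans (cong ((n' ∸ p) ! *_) (ℕP.*-zeroʳ ((suc p) !))) (ℕP.*-zeroʳ ((n' ∸ p) !))))
          (ℕP.*-zeroʳ (n' C p))

  Σ-blockTerm : ∀ n' t → wsum 1 t ≡ suc n' → Σℕ (suc n') (blockTerm n' t) ≡ (suc n') !
  Σ-blockTerm n' t hw = begin
      Σℕ (suc n') (blockTerm n' t)
    ≡⟨ Σℕ-cong (suc n') (λ p lt → blockTerm-value n' t p (ℕP.≤-pred lt)) ⟩
      Σℕ (suc n') (λ p → n' ! * (suc p * lookupE t p))
    ≡⟨ Σℕ-* (suc n') (n' !) _ ⟩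
      n' ! * Σℕ (suc n') (λ p → (1 + p) * lookupE t p)
    ≡⟨ cong (n' ! *_) (wsum-Σℕ 1 t (suc n') (λ p l → lookup-beyond-weight t (suc n') p hw l)) ⟩
      n' ! * wsum 1 t
    ≡⟨ cong (n' ! *_) hw ⟩
      n' ! * suc n'
    ≡⟨ ℕP.*-comm (n' !) (suc n') ⟩
      (suc n') ! ∎
    where open ≡-Reasoning

  -- The division defining bellCoeff is exact: by induction, den (decE t p)
  -- divides (n'-p)!, hence den t divides every blockTerm and their sum.
  den∣!-fuel : ∀ F n t → n ≤ F → wsum 1 t ≡ n → den 1 t ∣ n !
  den∣!-fuel F zero t _ hw =
    subst (_∣ 1) (sym (sumL0-den 1 t (ℕP.n≤0⇒n≡0 (subst (sumL t ≤_) hw (sumL≤wsum 1 t ℕP.≤-refl))))) (1∣ 1)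
  den∣!-fuel (suc F) (suc n') t (s≤s le) hw = subst (den 1 t ∣_) (Σ-blockTerm n' t hw) (Σℕ-∣ _ (suc n') _ tdiv)
    where
    tdiv : ∀ p → p < suc n' → den 1 t ∣ blockTerm n' t p
    tdiv p _ with lookup-pos-or-0 t p
    ... | inj₂ tₚ≡0 = subst (den 1 t ∣_) (sym (blockTerm-0 n' t p tₚ≡0)) (den 1 t ∣0)
    ... | inj₁ tₚ≥1 = ∣-trans den∣ (∣-trans (n∣m*n (n' C p)) (∣-reflexive reorder))
      where
      ih : den 1 (decE t p) ∣ (n' ∸ p) !
      ih = den∣!-fuel F (n' ∸ p) (decE t p) (ℕP.≤-trans (ℕP.m∸n≤m n' p) le) (wsum-removeBlock t (suc n') p hw tₚ≥1)
      den∣ : den 1 t ∣ (n' ∸ p) ! * (lookupE t p * (suc p) !)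
      den∣ = subst (_∣ (n' ∸ p) ! * (lookupE t p * (suc p) !)) (sym (den-decE 1 t p tₚ≥1)) (*-pres-∣ ih ∣-refl)
      reorder : (n' C p) * ((n' ∸ p) ! * (lookupE t p * (suc p) !)) ≡ blockTerm n' t p
      reorder = cong (λ z → (n' C p) * ((n' ∸ p) ! * z)) (ℕP.*-comm (lookupE t p) ((suc p) !))

  den∣! : ∀ n t → wsum 1 t ≡ n → den 1 t ∣ n !
  den∣! n t = den∣!-fuel n n t ℕP.≤-refl

  -- t is the type of a partition of n into k blocks; bellAt is the
  -- corresponding coefficient of B_{n,k}, and rhsAt the coefficient of the
  -- right-hand side of (ii), where removeBlock removes a block of size p+1.
  isType : ℕ → ℕ → List ℕ → Bool
  isType n k t = (sumL t ℕ.≡ᵇ k) ∧ (wsum 1 t ℕ.≡ᵇ n)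

  bellAt : ℕ → ℕ → List ℕ → ℕ
  bellAt n k t = if isType n k t then bellCoeff n t else 0

  removeBlock : ℕ → ℕ → List ℕ → ℕ → ℕ
  removeBlock n k t p = if 1 ℕ.≤ᵇ lookupE t p then bellAt (n ∸ suc p) (k ∸ 1) (decE t p) else 0

  rhsAt : ℕ → ℕ → List ℕ → ℕ
  rhsAt n k t = Σℕ (n ∸ k + 1) (λ p → ((n ∸ 1) C p) * removeBlock n k t p)
  isType-intro : ∀ n k t → sumL t ≡ k → wsum 1 t ≡ n → isType n k t ≡ true
  isType-intro n k t refl refl = cong₂ _∧_ (≡ᵇ-refl (sumL t)) (≡ᵇ-refl (wsum 1 t))

  isType-sumL : ∀ n k t → isType n k t ≡ true → sumL t ≡ k
  isType-sumL n k t e = ≡ᵇ-sound _ _ (∧-conicalˡ _ _ e)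
  isType-wsum : ∀ n k t → isType n k t ≡ true → wsum 1 t ≡ n
  isType-wsum n k t e = ≡ᵇ-sound _ _ (∧-conicalʳ _ _ e)

  bellCoeff*den : ∀ n t → wsum 1 t ≡ n → bellCoeff n t * den 1 t ≡ n !
  bellCoeff*den n t hw = m/n*n≡m {{den≢0 1 t}} (den∣! n t hw)

  div-≡ : ∀ a d d' .{{_ : ℕ.NonZero d}} .{{_ : ℕ.NonZero d'}} → d ≡ d' → a / d ≡ a / d'
  div-≡ a d .d refl = refl

  bellAt-≐ : ∀ n k r s → r ≐ s → bellAt n k r ≡ bellAt n k s
  bellAt-≐ n k r s h = cong₂ (λ b c → if b then c else 0)
    (cong₂ (λ a b → (a ℕ.≡ᵇ k) ∧ (b ℕ.≡ᵇ n)) (sumL-≐ r s h) (wsum-≐ 1 r s h))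
    (div-≡ (n !) (den 1 r) (den 1 s) {{den≢0 1 r}} {{den≢0 1 s}} (den-≐ 1 r s h))

  range≤n : ∀ n k → 1 ≤ k → k ≤ n → n ∸ k + 1 ≤ n
  range≤n n k k≥1 k≤n = subst (_≤ n) (trans (ℕP.+-∸-assoc 1 k≤n) (ℕP.+-comm 1 (n ∸ k))) (ℕP.∸-monoʳ-≤ {1} {k} (suc n) k≥1)

  removeBlock-0 : ∀ n k t p → lookupE t p ≡ 0 → removeBlock n k t p ≡ 0
  removeBlock-0 n k t p e rewrite e = refl

  removeBlock-pos : ∀ n k t p → 1 ≤ lookupE t p → removeBlock n k t p ≡ bellAt (n ∸ suc p) (k ∸ 1) (decE t p)
  removeBlock-pos n k t p h with lookupE t p
  removeBlock-pos n k t p (s≤s h) | suc l = refl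
  removeBlock-type : ∀ n k t p → 1 ≤ k → 1 ≤ lookupE t p → sumL t ≡ k → wsum 1 t ≡ n →
    isType (n ∸ suc p) (k ∸ 1) (decE t p) ≡ true
  removeBlock-type n k t p k≥1 tₚ≥1 hs hw = isType-intro (n ∸ suc p) (k ∸ 1) (decE t p)
    (ℕP.suc-injective (trans (sym (sumL-decE t p tₚ≥1)) (trans hs (sym (ℕP.suc-pred k {{ℕ.>-nonZero k≥1}})))))
    (wsum-removeBlock t n p hw tₚ≥1)

  addBlock-type : ∀ n k t p → 1 ≤ k → 1 ≤ lookupE t p → suc p ≤ n →
    isType (n ∸ suc p) (k ∸ 1) (decE t p) ≡ true → isType n k t ≡ true
  addBlock-type n k t p k≥1 tₚ≥1 p<n type = isType-intro n k t
    (trans (sumL-decE t p tₚ≥1) (trans (cong suc (isType-sumL _ _ (decE t p) type)) (ℕP.suc-pred k {{ℕ.>-nonZero k≥1}})))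
    (trans (wsum-decE 1 t p tₚ≥1) (trans (cong (_+ suc p) (isType-wsum _ _ (decE t p) type)) (ℕP.m∸n+n≡m p<n)))

  den*removeBlock : ∀ n' k t p → 1 ≤ k → sumL t ≡ k → wsum 1 t ≡ suc n' →
    den 1 t * ((n' C p) * removeBlock (suc n') k t p) ≡ blockTerm n' t p
  den*removeBlock n' k t p k≥1 hs hw with lookup-pos-or-0 t p
  ... | inj₂ tₚ≡0 = begin
      den 1 t * ((n' C p) * removeBlock (suc n') k t p)
    ≡⟨ cong (λ z → den 1 t * ((n' C p) * z)) (removeBlock-0 (suc n') k t p tₚ≡0) ⟩
      den 1 t * ((n' C p) * 0)
    ≡⟨ trans (cong (den 1 t *_) (ℕP.*-zeroʳ (n' C p))) (ℕP.*-zeroʳ (den 1 t)) ⟩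
      0
    ≡⟨ sym (blockTerm-0 n' t p tₚ≡0) ⟩
      blockTerm n' t p ∎
    where open ≡-Reasoning
  ... | inj₁ tₚ≥1 = begin
      den 1 t * ((n' C p) * removeBlock (suc n') k t p)
    ≡⟨ cong (λ z → den 1 t * ((n' C p) * z))
         (trans (removeBlock-pos (suc n') k t p tₚ≥1)
                (cong (λ b → if b then q else 0) (removeBlock-type (suc n') k t p k≥1 tₚ≥1 hs hw))) ⟩
      den 1 t * ((n' C p) * q)
    ≡⟨ cong (_* ((n' C p) * q)) (den-decE 1 t p tₚ≥1) ⟩
      (d * (lookupE t p * (suc p) !)) * ((n' C p) * q)
    ≡⟨ solve 5 (λ d l f c q → (d :* (l :* f)) :* (c :* q) := c :* ((q :* d) :* (f :* l)))
         refl d (lookupE t p) ((suc p) !) (n' C p) q ⟩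
      (n' C p) * ((q * d) * ((suc p) ! * lookupE t p))
    ≡⟨ cong (λ z → (n' C p) * (z * ((suc p) ! * lookupE t p)))
         (bellCoeff*den (n' ∸ p) (decE t p) (wsum-removeBlock t (suc n') p hw tₚ≥1)) ⟩
      blockTerm n' t p ∎
    where
    open ≡-Reasoning
    open +-*-Solver
    d = den 1 (decE t p)
    q = bellCoeff (n' ∸ p) (decE t p)

  blockTerm-beyond : ∀ n' k t p → sumL t ≡ k → wsum 1 t ≡ suc n' → suc n' ∸ k + 1 ≤ p → blockTerm n' t p ≡ 0
  blockTerm-beyond n' k t p hs hw R≤p with lookup-pos-or-0 t p
  ... | inj₂ tₚ≡0 = blockTerm-0 n' t p tₚ≡0
  ... | inj₁ tₚ≥1 = ⊥-elim (ℕP.<⇒≱ (subst (p <_) (ℕP.+-comm 1 (suc n' ∸ k))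
                       (s≤s (ℕP.m+n≤o⇒m≤o∸n p (block-bound t (suc n') k p hs hw tₚ≥1)))) R≤p)

  bell-recurrence-valid : ∀ n' k t → 1 ≤ k → k ≤ suc n' → sumL t ≡ k → wsum 1 t ≡ suc n' →
    bellCoeff (suc n') t ≡ rhsAt (suc n') k t
  bell-recurrence-valid n' k t k≥1 k≤n hs hw =
    ℕP.*-cancelʳ-≡ _ _ (den 1 t) {{den≢0 1 t}} (trans (bellCoeff*den n t hw) (sym rhs*den))
    where
    open ≡-Reasoning
    n = suc n'
    R = n ∸ k + 1
    rhs*den : rhsAt n k t * den 1 t ≡ n !
    rhs*den = begin
        rhsAt n k t * den 1 t
      ≡⟨ ℕP.*-comm (rhsAt n k t) (den 1 t) ⟩
        den 1 t * Σℕ R (λ p → (n' C p) * removeBlock n k t p)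
      ≡⟨ sym (Σℕ-* R (den 1 t) _) ⟩
        Σℕ R (λ p → den 1 t * ((n' C p) * removeBlock n k t p))
      ≡⟨ Σℕ-cong R (λ p _ → den*removeBlock n' k t p k≥1 hs hw) ⟩
        Σℕ R (blockTerm n' t)
      ≡⟨ Σℕ-extend R (blockTerm n' t) n (range≤n n k k≥1 k≤n) (λ p R≤p _ → blockTerm-beyond n' k t p hs hw R≤p) ⟩
        Σℕ n (blockTerm n' t)
      ≡⟨ Σ-blockTerm n' t hw ⟩
        n ! ∎

  -- The recurrence for all t: for t not a type of (n, k), no t - eₚ is a type
  -- of (n-1-p, k-1), so both sides vanish.
  bell-recurrence : ∀ n k t → 1 ≤ k → k ≤ n → bellAt n k t ≡ rhsAt n k t
  bell-recurrence n k t k≥1 k≤n with isType n k t in type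
  ... | true with n | k≤n
  ...   | zero   | le with () ← ℕP.≤-trans k≥1 le
  ...   | suc n' | le = bell-recurrence-valid n' k t k≥1 le (isType-sumL (suc n') k t type) (isType-wsum (suc n') k t type)
  bell-recurrence n k t k≥1 k≤n | false = sym (Σℕ-0 _ _ summand≡0)
    where
    summand≡0 : ∀ p → p < n ∸ k + 1 → ((n ∸ 1) C p) * removeBlock n k t p ≡ 0
    summand≡0 p lt with lookupE t p in tₚ
    ... | zero = ℕP.*-zeroʳ ((n ∸ 1) C p)
    ... | suc _ with isType (n ∸ suc p) (k ∸ 1) (decE t p) in type'
    ...   | false = ℕP.*-zeroʳ ((n ∸ 1) C p)
    ...   | true with () ← trans (sym type) (addBlock-type n k t p k≥1 (subst (1 ≤_) (sym tₚ) (s≤s z≤n))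
                                   (ℕP.≤-trans lt (range≤n n k k≥1 k≤n)) type')


-- B is a filtered enumeration of all
-- exponent tuples of bounded length and size, so the coefficient is a sum of
-- indicators over that enumeration, in which exactly the tuple equal to t
-- (up to trailing zeros) survives (tupleSum).
module BellPoly where

  open import Defs
  open Monomials
  open Linear
  open BellNumbers
  open import Data.Bool using (true; false; _∧_; if_then_else_; T)
  open import Data.Nat as ℕ using (ℕ; zero; suc; _∸_; _≤_; _<_; z≤n; s≤s)
  import Data.Nat.Properties as ℕP
  open import Data.Integer as ℤ using (ℤ; +_; -[1+_])
  import Data.Integer.Properties as ℤP
  open import Data.List using (List; []; _∷_; _++_; concatMap; map; foldr; upTo; filter; _∷ʳ_)
  import Data.List.Properties as LP
  open import Data.Product using (_×_; _,_)
  open import Function.Bundles using (mk⇔)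
  open import Relation.Binary.PropositionalEquality
  open import Relation.Nullary using (Dec; does)
  open import Relation.Nullary.Decidable using (⌊_⌋; isYes≗does; does-⇔; T?; _×-dec_)
  open import Data.Empty using (⊥-elim)
  open import Data.Sum using (_⊎_; inj₁; inj₂)

  sumOver : {A : Set} → List A → (A → ℤ) → ℤ
  sumOver xs F = foldr (λ x acc → F x ℤ.+ acc) (+ 0) xs

  sumOver-++ : ∀ {A : Set} (xs ys : List A) F → sumOver (xs ++ ys) F ≡ sumOver xs F ℤ.+ sumOver ys F
  sumOver-++ []       ys F = sym (ℤP.+-identityˡ _)
  sumOver-++ (x ∷ xs) ys F = trans (cong (ℤ._+_ (F x)) (sumOver-++ xs ys F)) (sym (ℤP.+-assoc (F x) _ _))

  sumOver-cong : ∀ {A : Set} (xs : List A) {F G : A → ℤ} → (∀ x → F x ≡ G x) → sumOver xs F ≡ sumOver xs G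
  sumOver-cong []       h = refl
  sumOver-cong (x ∷ xs) h = cong₂ ℤ._+_ (h x) (sumOver-cong xs h)

  sumOver-0 : ∀ {A : Set} (xs : List A) F → (∀ x → F x ≡ + 0) → sumOver xs F ≡ + 0
  sumOver-0 []       F h = refl
  sumOver-0 (x ∷ xs) F h rewrite h x = trans (ℤP.+-identityˡ _) (sumOver-0 xs F h)

  sumOver-map : ∀ {A B : Set} (g : A → B) xs F → sumOver (map g xs) F ≡ sumOver xs (λ x → F (g x))
  sumOver-map g []       F = refl
  sumOver-map g (x ∷ xs) F = cong (ℤ._+_ (F (g x))) (sumOver-map g xs F)

  sumOver-concatMap : ∀ {A B : Set} (f : A → List B) ys F →
    sumOver (concatMap f ys) F ≡ sumOver ys (λ y → sumOver (f y) F)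
  sumOver-concatMap f []       F = refl
  sumOver-concatMap f (y ∷ ys) F =
    trans (sumOver-++ (f y) (concatMap f ys) F) (cong (ℤ._+_ (sumOver (f y) F)) (sumOver-concatMap f ys F))

  sumOver-filter : ∀ {A : Set} {P : A → Set} (P? : (x : A) → Dec (P x)) xs F →
    sumOver (filter P? xs) F ≡ sumOver xs (λ x → if does (P? x) then F x else + 0)
  sumOver-filter P? []       F = refl
  sumOver-filter P? (x ∷ xs) F with does (P? x)
  ... | true  = cong (ℤ._+_ (F x)) (sumOver-filter P? xs F)
  ... | false = trans (sumOver-filter P? xs F) (sym (ℤP.+-identityˡ _))

  ≡ᵇ-false : ∀ x y → x ≢ y → (x ℕ.≡ᵇ y) ≡ false
  ≡ᵇ-false x y x≢y with x ℕ.≡ᵇ y in e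
  ... | false = refl
  ... | true  = ⊥-elim (x≢y (≡ᵇ-sound x y e))

  upTo-suc : ∀ n → upTo (suc n) ≡ upTo n ∷ʳ n
  upTo-suc n = sym (LP.applyUpTo-∷ʳ (λ y → y) n)

  indicator-outside : ∀ n x c → n ≤ x → sumOver (upTo n) (λ y → if x ℕ.≡ᵇ y then c else + 0) ≡ + 0
  indicator-outside zero    x c n≤x = refl
  indicator-outside (suc n) x c n<x = begin
      sumOver (upTo (suc n)) F
    ≡⟨ cong (λ l → sumOver l F) (upTo-suc n) ⟩
      sumOver (upTo n ∷ʳ n) F
    ≡⟨ sumOver-++ (upTo n) (n ∷ []) F ⟩
      sumOver (upTo n) F ℤ.+ (F n ℤ.+ + 0)
    ≡⟨ cong₂ (λ a b → a ℤ.+ ((if b then c else + 0) ℤ.+ + 0))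
         (indicator-outside n x c (ℕP.≤-trans (ℕP.n≤1+n n) n<x)) (≡ᵇ-false x n (λ x≡n → ℕP.<-irrefl (sym x≡n) n<x)) ⟩
      + 0 ∎
    where
    open ≡-Reasoning
    F : ℕ → ℤ
    F y = if x ℕ.≡ᵇ y then c else + 0

  indicator-inside : ∀ b x c → x ≤ b → sumOver (upTo (suc b)) (λ y → if x ℕ.≡ᵇ y then c else + 0) ≡ c
  indicator-inside b x c x≤b =
    trans (cong (λ l → sumOver l F) (upTo-suc b)) (trans (sumOver-++ (upTo b) (b ∷ []) F) (cases b x≤b (ℕP.m≤n⇒m<n∨m≡n x≤b)))
    where
    F : ℕ → ℤ
    F y = if x ℕ.≡ᵇ y then c else + 0
    cases : ∀ b → x ≤ b → x < b ⊎ x ≡ b → sumOver (upTo b) F ℤ.+ (F b ℤ.+ + 0) ≡ c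
    cases b _ (inj₂ refl) =
      trans (cong₂ (λ a e → a ℤ.+ ((if e then c else + 0) ℤ.+ + 0)) (indicator-outside x x c ℕP.≤-refl) (≡ᵇ-refl x))
            (trans (ℤP.+-identityˡ _) (ℤP.+-identityʳ c))
    cases (suc b') _ (inj₁ (s≤s x≤b')) =
      trans (cong₂ (λ a e → a ℤ.+ ((if e then c else + 0) ℤ.+ + 0))
              (indicator-inside b' x c x≤b') (≡ᵇ-false x (suc b') (λ x≡b → ℕP.<-irrefl x≡b (s≤s x≤b'))))
            (ℤP.+-identityʳ c)

  hd : List ℕ → ℕ
  hd []      = 0
  hd (x ∷ _) = x

  tl : List ℕ → List ℕ
  tl []       = []
  tl (_ ∷ xs) = xs

  hd∷tl : ∀ t → (hd t ∷ tl t) ≐ t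
  hd∷tl []      zero    = refl
  hd∷tl []      (suc i) = refl
  hd∷tl (x ∷ t) i       = refl

  eqExps-∷ : ∀ t y ys → eqExps t (y ∷ ys) ≡ (hd t ℕ.≡ᵇ y) ∧ eqExps (tl t) ys
  eqExps-∷ []      zero    ys = refl
  eqExps-∷ []      (suc y) ys = refl
  eqExps-∷ (x ∷ t) y       ys = refl

  Fits : ℕ → ℕ → List ℕ → Set
  Fits L b t = (∀ p → lookupE t p ≤ b) × (∀ p → L ≤ p → lookupE t p ≡ 0)

  Invariant≐ : (List ℕ → ℤ) → Set
  Invariant≐ H = ∀ r s → r ≐ s → H r ≡ H s

  -- Each fitting t occurs exactly once (up to ≐) in the enumeration tuples L b.
  tupleSum : ∀ L b t H → Invariant≐ H → Fits L b t →
    sumOver (tuples L b) (λ rs → if eqExps t rs then H rs else + 0) ≡ H t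
  tupleSum zero b t H inv (_ , t≡0) rewrite eqExps-complete t [] (λ i → t≡0 i z≤n) =
    trans (ℤP.+-identityʳ _) (inv [] t (λ i → sym (t≡0 i z≤n)))
  tupleSum (suc L) b t H inv (t≤b , t≡0) = begin
      sumOver (concatMap (λ r → map (r ∷_) (tuples L b)) (upTo (suc b))) F
    ≡⟨ sumOver-concatMap (λ r → map (r ∷_) (tuples L b)) (upTo (suc b)) F ⟩
      sumOver (upTo (suc b)) (λ y → sumOver (map (y ∷_) (tuples L b)) F)
    ≡⟨ sumOver-cong (upTo (suc b)) by-head ⟩
      sumOver (upTo (suc b)) (λ y → if hd t ℕ.≡ᵇ y then H t else + 0)
    ≡⟨ indicator-inside b (hd t) (H t) (head≤b t (t≤b 0)) ⟩
      H t ∎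
    where
    open ≡-Reasoning
    F : List ℕ → ℤ
    F rs = if eqExps t rs then H rs else + 0
    head≤b : ∀ t → lookupE t 0 ≤ b → hd t ≤ b
    head≤b []      _ = z≤n
    head≤b (x ∷ t) h = h
    lookup-tl : ∀ t p → lookupE (tl t) p ≡ lookupE t (suc p)
    lookup-tl []      p = refl
    lookup-tl (x ∷ t) p = refl
    tl-fits : Fits L b (tl t)
    tl-fits = (λ p → subst (_≤ b) (sym (lookup-tl t p)) (t≤b (suc p)))
            , (λ p l → trans (lookup-tl t p) (t≡0 (suc p) (s≤s l)))
    by-head : ∀ y → sumOver (map (y ∷_) (tuples L b)) F ≡ (if hd t ℕ.≡ᵇ y then H t else + 0)
    by-head y with hd t ℕ.≡ᵇ y in e
    ... | false = trans (sumOver-map (y ∷_) (tuples L b) F) (sumOver-0 (tuples L b) _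
                    (λ ys → cong (λ z → if z then H (y ∷ ys) else + 0) (trans (eqExps-∷ t y ys) (cong (_∧ eqExps (tl t) ys) e))))
    ... | true with ≡ᵇ-sound (hd t) y e
    ...   | refl = begin
        sumOver (map (hd t ∷_) (tuples L b)) F
      ≡⟨ sumOver-map (hd t ∷_) (tuples L b) F ⟩
        sumOver (tuples L b) (λ ys → F (hd t ∷ ys))
      ≡⟨ sumOver-cong (tuples L b) (λ ys → cong (λ z → if z then H (hd t ∷ ys) else + 0)
                                             (trans (eqExps-∷ t (hd t) ys) (cong (_∧ eqExps (tl t) ys) e))) ⟩
        sumOver (tuples L b) (λ ys → if eqExps (tl t) ys then H (hd t ∷ ys) else + 0)
      ≡⟨ tupleSum L b (tl t) (λ ys → H (hd t ∷ ys))
           (λ r s h → inv (hd t ∷ r) (hd t ∷ s) (λ { zero → refl ; (suc i) → h i })) tl-fits ⟩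
        H (hd t ∷ tl t)
      ≡⟨ inv _ _ (hd∷tl t) ⟩
        H t ∎

  isYes-+≟+ : ∀ x y → ⌊ + x ℤ.≟ + y ⌋ ≡ (x ℕ.≡ᵇ y)
  isYes-+≟+ x y = trans (isYes≗does (+ x ℤ.≟ + y))
    (does-⇔ (mk⇔ (λ e → ℕP.≡⇒≡ᵇ x y (ℤP.+-injective e)) (λ e → cong +_ (ℕP.≡ᵇ⇒≡ x y e)))
            (+ x ℤ.≟ + y) (T? (x ℕ.≡ᵇ y)))

  δ-rMon : ∀ x r rs → δ (+ x , r) (rMon rs) ≡ (if eqExps (x ∷ r) rs then + 1 else + 0)
  δ-rMon x r []       = cong (λ z → if z ∧ eqExps r [] then + 1 else + 0) (isYes-+≟+ x 0)
  δ-rMon x r (y ∷ ys) = cong (λ z → if z ∧ eqExps r ys then + 1 else + 0) (isYes-+≟+ x y)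

  δ-rMon-neg : ∀ x r rs → δ (-[1+ x ] , r) (rMon rs) ≡ + 0
  δ-rMon-neg x r []       = refl
  δ-rMon-neg x r (y ∷ ys) = refl

  does-≟ : ∀ m n → does (m ℕ.≟ n) ≡ (m ℕ.≡ᵇ n)
  does-≟ m n = does-⇔ (mk⇔ (ℕP.≡⇒≡ᵇ m n) (ℕP.≡ᵇ⇒≡ m n)) (m ℕ.≟ n) (T? (m ℕ.≡ᵇ n))

  bellAtℤ : ℕ → ℕ → Mon → ℤ
  bellAtℤ n k (+ x     , r) = + bellAt n k (x ∷ r)
  bellAtℤ n k (-[1+ x ] , r) = + 0

  B-unfold : ∀ n k' → suc k' ≤ n → B n (suc k') ≡ map (λ rs → (+ bellCoeff n rs , rMon rs))
        (filter (λ rs → (sumL rs ℕ.≟ suc k') ×-dec (wsum 1 rs ℕ.≟ n)) (tuples (n ∸ suc k' ℕ.+ 1) (suc k')))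
  B-unfold (suc n) k' le with suc k' ℕ.≤ᵇ suc n in eq
  ... | true  = refl
  ... | false = ⊥-elim (subst T eq (ℕP.≤⇒≤ᵇ le))

  linExt-map : ∀ g (c : List ℕ → ℤ) (μ : List ℕ → Mon) xs →
    linExt g (map (λ rs → (c rs , μ rs)) xs) ≡ sumOver xs (λ rs → c rs ℤ.* g (μ rs))
  linExt-map g c μ []       = refl
  linExt-map g c μ (x ∷ xs) = cong (ℤ._+_ (c x ℤ.* g (μ x))) (linExt-map g c μ xs)

  type-fits : ∀ n k t → isType n k t ≡ true → Fits (n ∸ k ℕ.+ 1) k t
  type-fits n k t type = (λ p → subst (lookupE t p ≤_) hs (lookup≤sumL t p)) , beyond
    where
    hs = isType-sumL n k t type
    hw = isType-wsum n k t type
    beyond : ∀ p → n ∸ k ℕ.+ 1 ≤ p → lookupE t p ≡ 0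
    beyond p R≤p with lookupE t p in tₚ
    ... | zero  = refl
    ... | suc _ = ⊥-elim (ℕP.<⇒≱ (subst (p ℕ.<_) (ℕP.+-comm 1 (n ∸ k))
                    (s≤s (ℕP.m+n≤o⇒m≤o∸n p (block-bound t n k p hs hw (subst (1 ≤_) (sym tₚ) (s≤s z≤n)))))) R≤p)

  select-type : ∀ n k t → sumOver (tuples (n ∸ k ℕ.+ 1) k) (λ rs → if eqExps t rs then + bellAt n k rs else + 0)
                          ≡ + bellAt n k t
  select-type n k t with isType n k t in type
  ... | true  = trans (tupleSum (n ∸ k ℕ.+ 1) k t H H-inv (type-fits n k t type))
                      (cong (λ b → + (if b then bellCoeff n t else 0)) type)
    where
    H : List ℕ → ℤ
    H rs = + bellAt n k rs
    H-inv : Invariant≐ H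
    H-inv r s h = cong +_ (bellAt-≐ n k r s h)
  ... | false = sumOver-0 (tuples (n ∸ k ℕ.+ 1) k) _ not-t
    where
    not-t : ∀ rs → (if eqExps t rs then + bellAt n k rs else + 0) ≡ + 0
    not-t rs with eqExps t rs in t≐rs
    ... | false = refl
    ... | true  = trans (cong +_ (sym (bellAt-≐ n k t rs (eqExps-sound t rs t≐rs))))
                        (cong (λ b → + (if b then bellCoeff n t else 0)) type)

  coeff-B-pos : ∀ n k' m → suc k' ≤ n → coeff (B n (suc k')) m ≡ bellAtℤ n (suc k') m
  coeff-B-pos n k' (e , r) le = begin
      coeff (B n k) (e , r)
    ≡⟨ cong (λ z → coeff z (e , r)) (B-unfold n k' le) ⟩
      coeff (map term (filter type? tuplesₙₖ)) (e , r)
    ≡⟨ coeff-linExt (map term (filter type? tuplesₙₖ)) (e , r) ⟩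
      linExt (δ (e , r)) (map term (filter type? tuplesₙₖ))
    ≡⟨ linExt-map (δ (e , r)) (λ rs → + bellCoeff n rs) rMon (filter type? tuplesₙₖ) ⟩
      sumOver (filter type? tuplesₙₖ) (λ rs → + bellCoeff n rs ℤ.* δ (e , r) (rMon rs))
    ≡⟨ sumOver-filter type? tuplesₙₖ _ ⟩
      sumOver tuplesₙₖ (λ rs → if does (type? rs) then + bellCoeff n rs ℤ.* δ (e , r) (rMon rs) else + 0)
    ≡⟨ by-sign e ⟩
      bellAtℤ n k (e , r) ∎
    where
    open ≡-Reasoning
    k = suc k'
    tuplesₙₖ = tuples (n ∸ k ℕ.+ 1) k
    term : List ℕ → ℤ × Mon
    term rs = (+ bellCoeff n rs , rMon rs)
    type? = λ rs → (sumL rs ℕ.≟ k) ×-dec (wsum 1 rs ℕ.≟ n)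
    does-type? : ∀ rs → does (type? rs) ≡ isType n k rs
    does-type? rs = cong₂ _∧_ (does-≟ (sumL rs) k) (does-≟ (wsum 1 rs) n)
    by-sign : ∀ e → sumOver tuplesₙₖ (λ rs → if does (type? rs) then + bellCoeff n rs ℤ.* δ (e , r) (rMon rs) else + 0)
                    ≡ bellAtℤ n k (e , r)
    by-sign -[1+ x ] = sumOver-0 tuplesₙₖ _ (λ rs → summand rs (does (type? rs)))
      where
      summand : ∀ rs b → (if b then + bellCoeff n rs ℤ.* δ (-[1+ x ] , r) (rMon rs) else + 0) ≡ + 0
      summand rs true  = trans (cong (ℤ._*_ (+ bellCoeff n rs)) (δ-rMon-neg x r rs)) (ℤP.*-zeroʳ (+ bellCoeff n rs))
      summand rs false = refl
    by-sign (+ x) = trans (sumOver-cong tuplesₙₖ summand) (select-type n k (x ∷ r))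
      where
      summand : ∀ rs → (if does (type? rs) then + bellCoeff n rs ℤ.* δ (+ x , r) (rMon rs) else + 0)
                       ≡ (if eqExps (x ∷ r) rs then + bellAt n k rs else + 0)
      summand rs rewrite does-type? rs | δ-rMon x r rs with eqExps (x ∷ r) rs | isType n k rs
      ... | true  | true  = ℤP.*-identityʳ (+ bellCoeff n rs)
      ... | false | true  = ℤP.*-zeroʳ (+ bellCoeff n rs)
      ... | true  | false = refl
      ... | false | false = refl

  bellAt-0-0 : ∀ t → bellAt 0 0 t ≡ (if eqExps t [] then 1 else 0)
  bellAt-0-0 t with eqExps t [] in t≐[]
  ... | true = trans (cong (λ b → if b then bellCoeff 0 t else 0) (isType-intro 0 0 t (AllZero-sumL t t≡0) (AllZero-wsum 1 t t≡0)))
                     (div-≡ 1 (den 1 t) 1 {{den≢0 1 t}} (AllZero-den 1 t t≡0))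
    where
    t≡0 : AllZero t
    t≡0 = eqExps-sound t [] t≐[]
  ... | false with isType 0 0 t in type
  ...   | false = refl
  ...   | true with () ← trans (sym (eqExps-complete t [] (sumL0-lookup t (isType-sumL 0 0 t type)))) t≐[]

  coeff-B-0 : ∀ n m → coeff (B n 0) m ≡ bellAtℤ n 0 m
  coeff-B-0 zero    (+ x , r) = begin
      coeff 1P (+ x , r)
    ≡⟨ trans (ℤP.+-identityʳ _) (δ-rMon x r []) ⟩
      (if eqExps (x ∷ r) [] then + 1 else + 0)
    ≡⟨ lift-if (eqExps (x ∷ r) []) ⟩
      + (if eqExps (x ∷ r) [] then 1 else 0)
    ≡⟨ cong +_ (sym (bellAt-0-0 (x ∷ r))) ⟩
      + bellAt 0 0 (x ∷ r) ∎
    where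
    open ≡-Reasoning
    lift-if : ∀ b → (if b then + 1 else + 0) ≡ + (if b then 1 else 0)
    lift-if true  = refl
    lift-if false = refl
  coeff-B-0 zero    (-[1+ x ] , r) = refl
  coeff-B-0 (suc n) (-[1+ x ] , r) = refl
  coeff-B-0 (suc n) (+ x , r) with isType (suc n) 0 (x ∷ r) in type
  ... | false = refl
  ... | true with () ← trans (sym (AllZero-wsum 1 (x ∷ r) (sumL0-lookup (x ∷ r) (isType-sumL (suc n) 0 (x ∷ r) type))))
                             (isType-wsum (suc n) 0 (x ∷ r) type)

  coeff-B : ∀ n k m → k ≤ n → coeff (B n k) m ≡ bellAtℤ n k m
  coeff-B n zero     m _  = coeff-B-0 n m
  coeff-B n (suc k') m le = coeff-B-pos n k' m le


-- Two facts about R are needed: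
-- B_{j,1} = X_j (the only type of (j,1) is a single block of size j), and
-- multiplication by a variable shifts coefficients: the coefficient of
-- X_{p+1} Q at m is that of Q at m / X_{p+1} (zero if X_{p+1} ∤ m, p ≥ 1).
-- With coeff-B both sides of (ii) become the two sides of bell-recurrence.
module PartII where

  open import Defs
  open Monomials
  open Linear
  open Ring
  open BellNumbers
  open BellPoly
  open import Data.Bool using (true; false; if_then_else_)
  open import Data.Nat as ℕ using (ℕ; zero; suc; _+_; _∸_; _≤_; _<_; z≤n; s≤s; _!)
  import Data.Nat.Properties as ℕP
  open import Data.Nat.Combinatorics using (_C_)
  open import Data.Nat.DivMod using (n/n≡1)
  open import Data.Integer as ℤ using (ℤ; +_; -[1+_])
  import Data.Integer.Properties as ℤP
  import Data.Integer.Solver as ℤ-Solver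
  open import Data.List using ([]; _∷_)
  open import Data.Product using (Σ; _,_)
  open import Data.Empty using (⊥-elim)
  open import Relation.Binary.PropositionalEquality
  open import Relation.Nullary using (yes; no; ¬_)

  -- The exponent list of X_{p+2} (a single block of size p+1).
  sumL-unitExps : ∀ p → sumL (unitExps p) ≡ 1
  sumL-unitExps zero    = refl
  sumL-unitExps (suc p) = sumL-unitExps p

  wsum-unitExps : ∀ i p → wsum i (unitExps p) ≡ i + p
  wsum-unitExps i zero    = trans (ℕP.+-identityʳ (i ℕ.* 1)) (trans (ℕP.*-identityʳ i) (sym (ℕP.+-identityʳ i)))
  wsum-unitExps i (suc p) = trans (cong (ℕ._+ wsum (suc i) (unitExps p)) (ℕP.*-zeroʳ i))
                                  (trans (wsum-unitExps (suc i) p) (sym (ℕP.+-suc i p)))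

  den-unitExps : ∀ i p → den i (unitExps p) ≡ (i + p) !
  den-unitExps i zero    = trans (ℕP.*-identityʳ _) (trans (ℕP.+-identityʳ _)
                             (trans (ℕP.*-identityʳ (i !)) (cong _! (sym (ℕP.+-identityʳ i)))))
  den-unitExps i (suc p) = trans (ℕP.+-identityʳ _) (trans (den-unitExps (suc i) p) (cong _! (sym (ℕP.+-suc i p))))

  lookup-unitExps-same : ∀ i → lookupE (unitExps i) i ≡ 1
  lookup-unitExps-same zero    = refl
  lookup-unitExps-same (suc i) = lookup-unitExps-same i

  lookup-unitExps-other : ∀ i k → i ≢ k → lookupE (unitExps i) k ≡ 0
  lookup-unitExps-other zero    zero    i≢k = ⊥-elim (i≢k refl)
  lookup-unitExps-other zero    (suc k) i≢k = refl
  lookup-unitExps-other (suc i) zero    i≢k = refl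
  lookup-unitExps-other (suc i) (suc k) i≢k = lookup-unitExps-other i k (λ e → i≢k (cong suc e))

  some-block : ∀ t → 1 ≤ sumL t → Σ ℕ (λ q → 1 ≤ lookupE t q)
  some-block (zero  ∷ t) h with some-block t h
  ... | q , t_q≥1 = suc q , t_q≥1
  some-block (suc x ∷ t) h = 0 , s≤s z≤n

  single-block : ∀ p t → sumL t ≡ 1 → wsum 1 t ≡ suc p → t ≐ unitExps p
  single-block p t hs hw with some-block t (ℕP.≤-reflexive (sym hs))
  ... | q , t_q≥1 = pointwise
    where
    rest≡0 : AllZero (decE t q)
    rest≡0 = sumL0-lookup (decE t q) (ℕP.suc-injective (trans (sym (sumL-decE t q t_q≥1)) hs))
    q≡p : q ≡ p
    q≡p = ℕP.suc-injective (trans (sym (trans (wsum-decE 1 t q t_q≥1)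
                                         (cong (ℕ._+ suc q) (AllZero-wsum 1 (decE t q) rest≡0)))) hw)
    pointwise : ∀ i → lookupE t i ≡ lookupE (unitExps p) i
    pointwise i with q ℕP.≟ i
    ... | yes refl = begin
        lookupE t q                   ≡⟨ sym (ℕP.m∸n+n≡m t_q≥1) ⟩
        lookupE t q ∸ 1 + 1           ≡⟨ cong (_+ 1) (trans (sym (lookup-decE-same t q)) (rest≡0 q)) ⟩
        1                             ≡⟨ sym (subst (λ z → lookupE (unitExps z) q ≡ 1) q≡p (lookup-unitExps-same q)) ⟩
        lookupE (unitExps p) q        ∎
      where open ≡-Reasoning
    ... | no q≢i = trans (sym (lookup-decE-other t q i q≢i))
                         (trans (rest≡0 i) (sym (lookup-unitExps-other p i (λ p≡i → q≢i (trans q≡p p≡i)))))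

  bellAt-1 : ∀ p t → bellAt (suc p) 1 t ≡ (if eqExps t (unitExps p) then 1 else 0)
  bellAt-1 p t with eqExps t (unitExps p) in t≐u
  ... | true = begin
      bellAt (suc p) 1 t
    ≡⟨ bellAt-≐ (suc p) 1 t (unitExps p) (eqExps-sound t _ t≐u) ⟩
      bellAt (suc p) 1 (unitExps p)
    ≡⟨ cong (λ b → if b then bellCoeff (suc p) (unitExps p) else 0)
         (isType-intro (suc p) 1 (unitExps p) (sumL-unitExps p) (wsum-unitExps 1 p)) ⟩
      bellCoeff (suc p) (unitExps p)
    ≡⟨ div-≡ (suc p !) (den 1 (unitExps p)) (suc p !) {{den≢0 1 (unitExps p)}} {{suc p ℕP.!≢0}} (den-unitExps 1 p) ⟩
      ℕ._/_ (suc p !) (suc p !) {{suc p ℕP.!≢0}}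
    ≡⟨ n/n≡1 (suc p !) {{suc p ℕP.!≢0}} ⟩
      1 ∎
    where open ≡-Reasoning
  ... | false with isType (suc p) 1 t in type
  ...   | false = refl
  ...   | true with () ← trans (sym (eqExps-complete t (unitExps p)
                                    (single-block p t (isType-sumL _ _ t type) (isType-wsum _ _ t type)))) t≐u

  coeff-X : ∀ p m → coeff (X (suc p)) m ≡ δ m (rMon (unitExps p))
  coeff-X zero    m = ℤP.+-identityʳ _
  coeff-X (suc i) m = ℤP.+-identityʳ _

  B-1≋X : ∀ p → B (suc p) 1 ≋ X (suc p)
  B-1≋X p = mk≋ λ m → trans (coeff-B (suc p) 1 m (s≤s z≤n)) (sym (trans (coeff-X p m) (by-sign m)))
    where
    by-sign : ∀ m → δ m (rMon (unitExps p)) ≡ bellAtℤ (suc p) 1 m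
    by-sign (+ x , r) = trans (δ-rMon x r (unitExps p))
      (sym (trans (cong +_ (bellAt-1 p (x ∷ r))) (lift-if (eqExps (x ∷ r) (unitExps p)))))
      where
      lift-if : ∀ b → + (if b then 1 else 0) ≡ (if b then + 1 else + 0)
      lift-if true  = refl
      lift-if false = refl
    by-sign (-[1+ x ] , r) = δ-rMon-neg x r (unitExps p)

  δ-iff : ∀ a b c d → (a ∼ b → c ∼ d) → (c ∼ d → a ∼ b) → δ a b ≡ δ c d
  δ-iff a b c d to from with eqMon a b in e₁ | eqMon c d in e₂
  ... | true  | true  = refl
  ... | false | false = refl
  ... | true  | false with () ← trans (sym (get∼ (to (mk∼ e₁)))) e₂
  ... | false | true  with () ← trans (sym (get∼ (from (mk∼ e₂)))) e₁

  δ-≁ : ∀ a b → ¬ (a ∼ b) → δ a b ≡ + 0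
  δ-≁ a b a≁b with eqMon a b in e
  ... | true  = ⊥-elim (a≁b (mk∼ e))
  ... | false = refl

  coeffAfterX : ℕ → Poly → Mon → ℤ
  coeffAfterX zero    Q (e , r) = coeff Q (e ℤ.- + 1 , r)
  coeffAfterX (suc i) Q (e , r) = if 1 ℕ.≤ᵇ lookupE r i then coeff Q (e , decE r i) else + 0

  δ-divide-X₁ : ∀ e r m₂ → δ (e , r) (mulMon (+ 1 , []) m₂) ≡ δ (e ℤ.- + 1 , r) m₂
  δ-divide-X₁ e r (e₂ , r₂) = δ-iff (e , r) (+ 1 ℤ.+ e₂ , r₂) (e ℤ.- + 1 , r) (e₂ , r₂)
    (λ h → let me = ∼⇒MonEq h in MonEq⇒∼ (meq
      (trans (cong (ℤ._- + 1) (fstEq me)) (solve 1 (λ x → con (+ 1) :+ x :- con (+ 1) := x) refl e₂)) (lkEq me)))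
    (λ h → let me = ∼⇒MonEq h in MonEq⇒∼ (meq
      (trans (solve 1 (λ x → x := con (+ 1) :+ (x :- con (+ 1))) refl e) (cong (ℤ._+_ (+ 1)) (fstEq me))) (lkEq me)))
    where open ℤ-Solver.+-*-Solver

  δ-divide-X : ∀ i e r m₂ → 1 ≤ lookupE r i →
    δ (e , r) (mulMon (+ 0 , unitExps i) m₂) ≡ δ (e , decE r i) m₂
  δ-divide-X i e r (e₂ , r₂) rᵢ≥1 =
    δ-iff (e , r) (+ 0 ℤ.+ e₂ , addExps (unitExps i) r₂) (e , decE r i) (e₂ , r₂) divide multiply
    where
    lookup-u+ : ∀ k → lookupE (addExps (unitExps i) r₂) k ≡ lookupE (unitExps i) k + lookupE r₂ k
    lookup-u+ = lookup-add (unitExps i) r₂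
    divide : (e , r) ∼ (+ 0 ℤ.+ e₂ , addExps (unitExps i) r₂) → (e , decE r i) ∼ (e₂ , r₂)
    divide h = MonEq⇒∼ (meq (trans (fstEq me) (ℤP.+-identityˡ e₂)) pointwise)
      where
      me = ∼⇒MonEq h
      pointwise : ∀ k → lookupE (decE r i) k ≡ lookupE r₂ k
      pointwise k with i ℕP.≟ k
      ... | yes refl = trans (lookup-decE-same r i)
                         (trans (cong (_∸ 1) (trans (lkEq me i) (lookup-u+ i)))
                                (cong (λ z → z + lookupE r₂ i ∸ 1) (lookup-unitExps-same i)))
      ... | no i≢k = trans (lookup-decE-other r i k i≢k)
                       (trans (lkEq me k) (trans (lookup-u+ k) (cong (_+ lookupE r₂ k) (lookup-unitExps-other i k i≢k))))
    multiply : (e , decE r i) ∼ (e₂ , r₂) → (e , r) ∼ (+ 0 ℤ.+ e₂ , addExps (unitExps i) r₂)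
    multiply h = MonEq⇒∼ (meq (trans (fstEq me) (sym (ℤP.+-identityˡ e₂))) pointwise)
      where
      me = ∼⇒MonEq h
      pointwise : ∀ k → lookupE r k ≡ lookupE (addExps (unitExps i) r₂) k
      pointwise k with i ℕP.≟ k
      ... | yes refl = begin
          lookupE r i                                  ≡⟨ sym (ℕP.m∸n+n≡m rᵢ≥1) ⟩
          lookupE r i ∸ 1 + 1                          ≡⟨ ℕP.+-comm _ 1 ⟩
          1 + (lookupE r i ∸ 1)                        ≡⟨ cong (_+_ 1) (trans (sym (lookup-decE-same r i)) (lkEq me i)) ⟩
          1 + lookupE r₂ i                             ≡⟨ cong (_+ lookupE r₂ i) (sym (lookup-unitExps-same i)) ⟩
          lookupE (unitExps i) i + lookupE r₂ i        ≡⟨ sym (lookup-u+ i) ⟩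
          lookupE (addExps (unitExps i) r₂) i          ∎
        where open ≡-Reasoning
      ... | no i≢k = trans (sym (lookup-decE-other r i k i≢k))
                       (trans (lkEq me k) (sym (trans (lookup-u+ k) (cong (_+ lookupE r₂ k) (lookup-unitExps-other i k i≢k)))))

  δ-not-divisible-X : ∀ i e r m₂ → lookupE r i ≡ 0 → δ (e , r) (mulMon (+ 0 , unitExps i) m₂) ≡ + 0
  δ-not-divisible-X i e r (e₂ , r₂) rᵢ≡0 = δ-≁ _ _ not-divisible
    where
    not-divisible : ¬ ((e , r) ∼ (+ 0 ℤ.+ e₂ , addExps (unitExps i) r₂))
    not-divisible h with trans (sym rᵢ≡0) (trans (lkEq (∼⇒MonEq h) i) (lookup-add (unitExps i) r₂ i))
    ... | 0≡1+ rewrite lookup-unitExps-same i with () ← 0≡1+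

  coeff-X* : ∀ p Q m → coeff (X (suc p) *P Q) m ≡ coeffAfterX p Q m
  coeff-X* zero Q (e , r) = begin
      coeff (X 1 *P Q) (e , r)
    ≡⟨ trans (coeff-* (X 1) Q (e , r)) (trans (ℤP.+-identityʳ _) (ℤP.*-identityˡ _)) ⟩
      linExt (λ m₂ → δ (e , r) (mulMon (+ 1 , []) m₂)) Q
    ≡⟨ linExt-ext Q (δ-divide-X₁ e r) ⟩
      linExt (δ (e ℤ.- + 1 , r)) Q
    ≡⟨ sym (coeff-linExt Q (e ℤ.- + 1 , r)) ⟩
      coeff Q (e ℤ.- + 1 , r) ∎
    where open ≡-Reasoning
  coeff-X* (suc i) Q (e , r) =
    trans (coeff-* (X (suc (suc i))) Q (e , r)) (trans (ℤP.+-identityʳ _) (trans (ℤP.*-identityˡ _) (by-exponent (lookupE r i) refl)))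
    where
    by-exponent : ∀ v → lookupE r i ≡ v →
      linExt (λ m₂ → δ (e , r) (mulMon (+ 0 , unitExps i) m₂)) Q ≡ coeffAfterX (suc i) Q (e , r)
    by-exponent zero    rᵢ rewrite rᵢ = trans (linExt-ext Q (λ m₂ → δ-not-divisible-X i e r m₂ rᵢ)) (linExt-0 Q)
    by-exponent (suc v) rᵢ rewrite rᵢ =
      trans (linExt-ext Q (λ m₂ → δ-divide-X i e r m₂ (subst (1 ≤_) (sym rᵢ) (s≤s z≤n))))
            (sym (coeff-linExt Q (e , decE r i)))

  Σℤ : ℕ → (ℕ → ℤ) → ℤ
  Σℤ zero    f = + 0
  Σℤ (suc R) f = Σℤ R f ℤ.+ f R

  coeff-Σ< : ∀ R g m → coeff (Σ< R g) m ≡ Σℤ R (λ i → coeff (g i) m)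
  coeff-Σ< zero    g m = refl
  coeff-Σ< (suc R) g m = trans (coeff-++ (Σ< R g) (g R) m) (cong (ℤ._+ coeff (g R) m) (coeff-Σ< R g m))

  Σℤ-cong : ∀ R {f g} → (∀ i → i < R → f i ≡ g i) → Σℤ R f ≡ Σℤ R g
  Σℤ-cong zero    h = refl
  Σℤ-cong (suc R) h = cong₂ ℤ._+_ (Σℤ-cong R (λ i l → h i (ℕP.m≤n⇒m≤1+n l))) (h R ℕP.≤-refl)

  Σℤ-+ : ∀ R f → Σℤ R (λ i → + f i) ≡ + Σℕ R f
  Σℤ-+ zero    f = refl
  Σℤ-+ (suc R) f = trans (cong (ℤ._+ + f R) (Σℤ-+ R f)) (sym (ℤP.pos-+ (Σℕ R f) (f R)))

  coeffAfterX-B : ∀ n k i x r → k ∸ 1 ≤ n ∸ suc i →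
    coeffAfterX i (B (n ∸ suc i) (k ∸ 1)) (+ x , r) ≡ + removeBlock n k (x ∷ r) i
  coeffAfterX-B n k zero    zero    r le = coeff-B (n ∸ 1) (k ∸ 1) _ le
  coeffAfterX-B n k zero    (suc x) r le = coeff-B (n ∸ 1) (k ∸ 1) _ le
  coeffAfterX-B n k (suc i) x r le with 1 ℕ.≤ᵇ lookupE r i
  ... | true  = coeff-B (n ∸ suc (suc i)) (k ∸ 1) _ le
  ... | false = refl

  coeffAfterX-B-neg : ∀ n k i y r → k ∸ 1 ≤ n ∸ suc i →
    coeffAfterX i (B (n ∸ suc i) (k ∸ 1)) (-[1+ y ] , r) ≡ + 0
  coeffAfterX-B-neg n k zero    y r le = coeff-B (n ∸ 1) (k ∸ 1) _ le
  coeffAfterX-B-neg n k (suc i) y r le with 1 ℕ.≤ᵇ lookupE r i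
  ... | true  = coeff-B (n ∸ suc (suc i)) (k ∸ 1) _ le
  ... | false = refl

  -- Part (ii): at a type t both sides are the two sides of bell-recurrence.
  partII : ∀ n k → 1 ≤ k → k ≤ n →
    B n k ≈ ΣP (n ∸ k + 1) (λ j → (+ ((n ∸ 1) C (j ∸ 1))) ·P (B j 1 *P B (n ∸ j) (k ∸ 1)))
  partII n (suc k') _ k≤n m = trans (coeff-B n k m k≤n) (sym (begin
      coeff (ΣP R _) m
    ≡⟨ cong (λ z → coeff z m) (ΣP≡Σ< R _) ⟩
      coeff (Σ< R summand) m
    ≡⟨ coeff-Σ< R summand m ⟩
      Σℤ R (λ i → coeff (summand i) m)
    ≡⟨ Σℤ-cong R (λ i _ → coeff-summand i) ⟩
      Σℤ R (λ i → c i ℤ.* coeffAfterX i (B (n ∸ suc i) k') m)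
    ≡⟨ by-sign m ⟩
      bellAtℤ n k m ∎))
    where
    open ≡-Reasoning
    k = suc k'
    R = n ∸ k + 1
    c : ℕ → ℤ
    c i = + ((n ∸ 1) C i)
    summand : ℕ → Poly
    summand i = c i ·P (B (suc i) 1 *P B (n ∸ suc i) k')
    coeff-summand : ∀ i → coeff (summand i) m ≡ c i ℤ.* coeffAfterX i (B (n ∸ suc i) k') m
    coeff-summand i = trans (coeff-· (c i) (B (suc i) 1 *P B (n ∸ suc i) k') m)
      (cong (c i ℤ.*_) (trans (get≋ (*-cong (B-1≋X i) (≋-refl {B (n ∸ suc i) k'})) m) (coeff-X* i (B (n ∸ suc i) k') m)))
    index-bound : ∀ i → i < R → k' ≤ n ∸ suc i
    index-bound i i<R = ℕP.m+n≤o⇒m≤o∸n k' (subst (_≤ n) (trans (ℕP.+-suc i k') (ℕP.+-comm (suc i) k'))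
      (ℕP.m≤o∸n⇒m+n≤o i k≤n (ℕP.≤-pred (subst (suc i ≤_) (ℕP.+-comm (n ∸ k) 1) i<R))))
    by-sign : ∀ m → Σℤ R (λ i → c i ℤ.* coeffAfterX i (B (n ∸ suc i) k') m) ≡ bellAtℤ n k m
    by-sign (-[1+ y ] , r) = trans (Σℤ-cong R (λ i i<R →
        trans (cong (c i ℤ.*_) (coeffAfterX-B-neg n k i y r (index-bound i i<R))) (ℤP.*-zeroʳ (c i))))
      (Σℤ-0 R)
      where
      Σℤ-0 : ∀ R → Σℤ R (λ _ → + 0) ≡ + 0
      Σℤ-0 zero    = refl
      Σℤ-0 (suc R) = cong (ℤ._+ + 0) (Σℤ-0 R)
    by-sign (+ x , r) = begin
        Σℤ R (λ i → c i ℤ.* coeffAfterX i (B (n ∸ suc i) k') (+ x , r))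
      ≡⟨ Σℤ-cong R (λ i i<R → trans (cong (c i ℤ.*_) (coeffAfterX-B n k i x r (index-bound i i<R)))
                                    (sym (ℤP.pos-* ((n ∸ 1) C i) _))) ⟩
        Σℤ R (λ i → + (((n ∸ 1) C i) ℕ.* removeBlock n k (x ∷ r) i))
      ≡⟨ Σℤ-+ R _ ⟩
        + rhsAt n k (x ∷ r)
      ≡⟨ cong +_ (sym (bell-recurrence n k (x ∷ r) (s≤s z≤n) k≤n)) ⟩
        + bellAt n k (x ∷ r) ∎

open import Defs
open import Data.Nat using (ℕ; _≤_; _∸_; _+_)
open import Data.Nat.Combinatorics using (_C_)
open import Data.Integer using (+_)
open import Data.Product using (_×_; _,_)

proposition5p5 : ∀ (n k : ℕ) → 1 ≤ k → k ≤ n →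
    (A n k ≈ ΣP (n ∸ k + 1) (λ j → (+ ((n ∸ 1) C (j ∸ 1))) ·P (A j 1 *P A (n ∸ j) (k ∸ 1))))
    × (B n k ≈ ΣP (n ∸ k + 1) (λ j → (+ ((n ∸ 1) C (j ∸ 1))) ·P (B j 1 *P B (n ∸ j) (k ∸ 1))))
proposition5p5 n k k≥1 k≤n = PartI.partI n k k≥1 k≤n , PartII.partII n k k≥1 k≤n
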